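{- Let $X$ and $y$ be indeterminates. In the ring of formal power series in $t$ with coefficients in $\mathbb{Q}[X,y]$, $$\sum_{|\mu|\geq 1} t^{|\mu|}\,\frac{X^{l(\mu)-1}}{z_\mu}\sum_{i=1}^{l(\mu)}\bigl(y^{\mu_i}-1\bigr)=\sum_{n\geq 1} t^n\sum_{k=1}^{n}\binom{X+n-1}{n-k}\frac{(y-1)^k}{k},$$ where the left-hand sum runs over all nonempty integer partitions $\mu$.
   Context: A partition $\mu=(\mu_1\geq\mu_2\geq\cdots\geq\mu_l>0)$ of $n=|\mu|=\sum_i\mu_i$ has length $l(\mu)=l$; $m_i(\mu)=\#\{j:\mu_j=i\}$ is the multiplicity of $i$ in $\mu$, and $z_\mu=\prod_{i\geq1} i^{m_i(\mu)}\,m_i(\mu)!$. For an integer $s\ge 0$, $\binom{X+n-1}{s}$ denotes the polynomial $(X+n-1)(X+n-2)\cdots(X+n-s)/s!$ in $X$. -}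

module Defs where

open import Data.Nat as ℕ using (ℕ; zero; suc; _∸_; _≥_)
open import Data.Nat using (_!)
open import Data.Nat.ListAction using (sum)
open import Data.Integer using (+_)
open import Data.Rational using (ℚ; 0ℚ; 1ℚ; _/_) renaming (_+_ to _+ℚ_; _*_ to _*ℚ_; -_ to -ℚ_)
open import Data.List using (List; []; _∷_; map; foldr; length; filter; upTo)
open import Data.List.Relation.Unary.All using (All)
open import Data.List.Relation.Unary.Linked using (Linked)
open import Relation.Binary.PropositionalEquality using (_≡_)
open import Data.Product using (_×_)

IsPartition : ℕ → List ℕ → Set
IsPartition n μ = All (λ p → p ≥ 1) μ × Linked _≥_ μ × (sum μ ≡ n)


mult : ℕ → List ℕ → ℕ
mult i μ = length (filter (ℕ._≟ i) μ)

-- z_μ = ∏_{i ≥ 1} i^{m_i(μ)} m_i(μ)!   (factors with i > |μ| are 1)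
zee : List ℕ → ℕ
zee μ = foldr (λ i acc → (i ℕ.^ mult i μ) ℕ.* ((mult i μ) !) ℕ.* acc) 1
              (map suc (upTo (sum μ)))

-- ℚ[X,y], embedded in the formal power series ring ℚ[[X,y]]:
-- an element is its coefficient function, p a b = coefficient of X^a y^b.

Poly : Set
Poly = ℕ → ℕ → ℚ

_≐_ : Poly → Poly → Set
p ≐ q = ∀ a b → p a b ≡ q a b

sumTo : ℕ → (ℕ → ℚ) → ℚ
sumTo a f = foldr (λ i acc → f i +ℚ acc) 0ℚ (upTo (suc a))

0P : Poly
0P a b = 0ℚ

cst : ℚ → Poly
cst c zero zero = c
cst c _    _    = 0ℚ

1P : Poly
1P = cst 1ℚ

Xv : Poly
Xv (suc zero) zero = 1ℚ
Xv _ _ = 0ℚ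

Yv : Poly
Yv zero (suc zero) = 1ℚ
Yv _ _ = 0ℚ

_⊕_ : Poly → Poly → Poly
(p ⊕ q) a b = p a b +ℚ q a b

⊝_ : Poly → Poly
(⊝ p) a b = -ℚ (p a b)

_⊖_ : Poly → Poly → Poly
p ⊖ q = p ⊕ (⊝ q)

_⊛_ : Poly → Poly → Poly
(p ⊛ q) a b = sumTo a (λ i → sumTo b (λ j → p i j *ℚ q (a ∸ i) (b ∸ j)))

_·_ : ℚ → Poly → Poly
(c · p) a b = c *ℚ p a b

infixl 6 _⊕_ _⊖_
infixl 7 _⊛_ _·_

_^P_ : Poly → ℕ → Poly
p ^P zero = 1P
p ^P suc k = p ⊛ (p ^P k)

sumP : List Poly → Poly
sumP = foldr _⊕_ 0P

prodP : List Poly → Poly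
prodP = foldr _⊛_ 1P

-- natural number as a rational, and its reciprocal (recip 0 = 0, never used)
ℕtoℚ : ℕ → ℚ
ℕtoℚ k = (+ k) / 1

recip : ℕ → ℚ
recip zero = 0ℚ
recip (suc k) = (+ 1) / suc k

-- binom(X+n-1, s) = (X+n-1)(X+n-2)...(X+n-s)/s!
binomX : ℕ → ℕ → Poly
binomX n s = recip (s !) · prodP (map (λ j → Xv ⊕ cst (ℕtoℚ (n ∸ suc j))) (upTo s))

-- Coefficient of t^n on each side.

lhsTerm : List ℕ → Poly
lhsTerm μ = recip (zee μ) · ((Xv ^P (length μ ∸ 1)) ⊛ sumP (map (λ p → (Yv ^P p) ⊖ 1P) μ))

lhsCoeff : List (List ℕ) → Poly
lhsCoeff L = sumP (map lhsTerm L)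

rhsCoeff : ℕ → Poly
rhsCoeff n = sumP (map (λ k → recip k · (binomX n (n ∸ k) ⊛ ((Yv ⊖ 1P) ^P k)))
                       (map suc (upTo n)))

-- Compare coefficients of t^n.  Deleting one copy of a part b from a partition μ of n gives a
-- partition ν of n − b with z_μ = z_ν · b · m_b(μ) and l(ν) = l(μ) − 1, and each ν arises
-- exactly once.  As Σ_i f(μ_i) = Σ_b m_b(μ) f(b), this gives for every f
--   Σ_{μ ⊢ n} X^{l(μ)−1}/z_μ · Σ_i f(μ_i) = Σ_{b=1}^{n} f(b)/b · S(n − b),
-- where S(m) = Σ_{ν ⊢ m} X^{l(ν)}/z_ν.  For f(b) = b this is m S(m) = X Σ_{b=1}^{m} S(m − b),
-- a recurrence that binom(X+m−1, m) also satisfies, so S(m) = binom(X+m−1, m).  For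
-- f(b) = y^b − 1, expand y^b − 1 = Σ_k binom(b,k) (y−1)^k, use binom(b,k)/b = binom(b−1,k−1)/k
-- and the Chu–Vandermonde identity Σ_b binom(b−1,k−1) binom(X+n−b−1, n−b) = binom(X+n−1, n−k).

module Submission where

open import Defs
open import Algebra.Bundles using (CommutativeMonoid; CommutativeRing)
open import Data.Empty using (⊥-elim)
open import Data.Nat as ℕ using (ℕ; zero; suc; _∸_; _≤_; _<_; _≥_; _≟_; _≤?_; z≤n; s≤s)
import Data.Nat.Properties as ℕ
open import Data.Nat.Combinatorics using (_C_; nC1≡n; k>n⇒nCk≡0; nCk+nC[k+1]≡[n+1]C[k+1])
open import Data.Nat.Induction using (<-rec)
open import Data.Nat.ListAction using (sum)
open import Data.Nat.ListAction.Properties using (sum-↭)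
open import Data.List using (List; []; _∷_; foldr; map; filter; length; upTo; applyUpTo)
import Data.List.Properties as List
open import Data.List.Membership.Propositional using (_∈_; _∉_)
import Data.List.Membership.Propositional.Properties as ∈
open import Data.List.Membership.DecPropositional _≟_ using (_∈?_)
open import Data.List.Relation.Binary.Permutation.Propositional
  using (_↭_; ↭-refl; ↭-trans; ↭-sym; ↭-prep; ↭-swap; ↭⇒↭ₛ)
open import Data.List.Relation.Binary.Permutation.Propositional.Properties
  using (↭-length; filter-↭; All-resp-↭; Any-resp-↭; drop-∷)
open import Data.List.Relation.Binary.Pointwise using (Pointwise-≡⇒≡)
open import Data.List.Relation.Unary.All as All using (All; []; _∷_)
open import Data.List.Relation.Unary.AllPairs using (AllPairs; []; _∷_)
open import Data.List.Relation.Unary.Any as Any using (here; there)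
open import Data.List.Relation.Unary.Linked as Linked using (Linked)
open import Data.List.Relation.Unary.Linked.Properties using (Linked⇒AllPairs; AllPairs⇒Linked)
open import Data.List.Relation.Unary.Sorted.TotalOrder.Properties using (↗↭↗⇒≋)
open import Data.List.Relation.Unary.Unique.Propositional using (Unique)
import Data.List.Relation.Unary.Unique.Propositional.Properties as Unique
open import Data.Product using (_,_; proj₁; proj₂)
open import Data.Rational as ℚ using (ℚ; 0ℚ; 1ℚ; fromℚᵘ)
import Data.Rational.Properties as ℚ
open import Data.Sum using (inj₁; inj₂)
open import Function.Bundles using (_⇔_; mk⇔; Equivalence)
open import Level using (0ℓ)
open import Relation.Binary.Definitions using (tri<; tri≈; tri>)
open import Relation.Binary.Properties.DecTotalOrder ℕ.≤-decTotalOrder using (≥-decTotalOrder; ≥-totalOrder; ≥-trans)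
open import Relation.Binary.PropositionalEquality as ≡ using (_≡_; _≢_)
open import Relation.Nullary using (¬_; yes; no)
open import Relation.Unary using (Pred; Decidable)
import Data.List.Sort ≥-decTotalOrder as ≥-Sort

module FiniteSum {c ℓ} (M : CommutativeMonoid c ℓ) where

  open CommutativeMonoid M renaming (Carrier to A)
  open import Algebra.Properties.CommutativeSemigroup commutativeSemigroup using (interchange; xy∙z≈xz∙y)
  open import Relation.Binary.Reasoning.Setoid setoid

  ∑ : ℕ → (ℕ → A) → A
  ∑ zero    f = ε
  ∑ (suc n) f = ∑ n f ∙ f n

  syntax ∑ n (λ i → x) = ∑[ i < n ] x

  ∑-cong-< : ∀ n {f g} → (∀ i → i < n → f i ≈ g i) → ∑ n f ≈ ∑ n g
  ∑-cong-< zero    f≈g = refl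
  ∑-cong-< (suc n) f≈g = ∙-cong (∑-cong-< n (λ i i<n → f≈g i (ℕ.m<n⇒m<1+n i<n))) (f≈g n ℕ.≤-refl)

  ∑-bound-≡ : ∀ {m n} f → m ≡ n → ∑ m f ≈ ∑ n f
  ∑-bound-≡ f ≡.refl = refl

  ∑-cong : ∀ n {f g} → (∀ i → f i ≈ g i) → ∑ n f ≈ ∑ n g
  ∑-cong n f≈g = ∑-cong-< n (λ i _ → f≈g i)

  ∑-ε : ∀ n {f} → (∀ i → i < n → f i ≈ ε) → ∑ n f ≈ ε
  ∑-ε n {f} f≈ε = trans (∑-cong-< n f≈ε) (∑-const-ε n)
    where
    ∑-const-ε : ∀ n → ∑ n (λ _ → ε) ≈ ε
    ∑-const-ε zero    = refl
    ∑-const-ε (suc n) = trans (identityʳ _) (∑-const-ε n)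

  ∑-unfoldˡ : ∀ n f → ∑ (suc n) f ≈ f 0 ∙ ∑ n (λ i → f (suc i))
  ∑-unfoldˡ zero    f = trans (identityˡ (f 0)) (sym (identityʳ (f 0)))
  ∑-unfoldˡ (suc n) f = begin
    (∑ n f ∙ f n) ∙ f (suc n)                   ≈⟨ ∙-congʳ (∑-unfoldˡ n f) ⟩
    (f 0 ∙ ∑ n (λ i → f (suc i))) ∙ f (suc n)   ≈⟨ assoc _ _ _ ⟩
    f 0 ∙ (∑ n (λ i → f (suc i)) ∙ f (suc n))   ∎

  ∑-distrib-∙ : ∀ n f g → ∑[ i < n ] (f i ∙ g i) ≈ ∑ n f ∙ ∑ n g
  ∑-distrib-∙ zero    f g = sym (identityˡ ε)
  ∑-distrib-∙ (suc n) f g = begin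
    ∑[ i < n ] (f i ∙ g i) ∙ (f n ∙ g n) ≈⟨ ∙-congʳ (∑-distrib-∙ n f g) ⟩
    (∑ n f ∙ ∑ n g) ∙ (f n ∙ g n)        ≈⟨ interchange _ _ _ _ ⟩
    (∑ n f ∙ f n) ∙ (∑ n g ∙ g n)        ∎

  ∑-comm : ∀ m n (f : ℕ → ℕ → A) → ∑[ i < m ] ∑[ j < n ] f i j ≈ ∑[ j < n ] ∑[ i < m ] f i j
  ∑-comm zero    n f = sym (∑-ε n (λ _ _ → refl))
  ∑-comm (suc m) n f = trans (∙-congʳ (∑-comm m n f)) (sym (∑-distrib-∙ n _ _))

  ∑-extend : ∀ m n f → m ≤ n → (∀ i → m ≤ i → i < n → f i ≈ ε) → ∑ m f ≈ ∑ n f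
  ∑-extend m zero    f z≤n   _   = refl
  ∑-extend m (suc n) f m≤1+n f≈ε with ℕ.m≤n⇒m<n∨m≡n m≤1+n
  ... | inj₂ ≡.refl = refl
  ... | inj₁ (s≤s m≤n) = begin
    ∑ m f       ≈⟨ ∑-extend m n f m≤n (λ i m≤i i<n → f≈ε i m≤i (ℕ.m<n⇒m<1+n i<n)) ⟩
    ∑ n f       ≈⟨ sym (identityʳ _) ⟩
    ∑ n f ∙ ε   ≈⟨ ∙-congˡ (sym (f≈ε n m≤n ℕ.≤-refl)) ⟩
    ∑ n f ∙ f n ∎

  ∑-update : ∀ n k f g x → k < n → (∀ i → i < n → i ≢ k → f i ≈ g i) → f k ≈ g k ∙ x →
             ∑ n f ≈ ∑ n g ∙ x
  ∑-update (suc n) k f g x k<1+n f≈g fk≈gk∙x with ℕ.m≤n⇒m<n∨m≡n (ℕ.≤-pred k<1+n)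
  ... | inj₂ ≡.refl = begin
    ∑ n f ∙ f n       ≈⟨ ∙-cong (∑-cong-< n (λ i i<n → f≈g i (ℕ.m<n⇒m<1+n i<n) (ℕ.<⇒≢ i<n))) fk≈gk∙x ⟩
    ∑ n g ∙ (g n ∙ x) ≈⟨ sym (assoc _ _ _) ⟩
    (∑ n g ∙ g n) ∙ x ∎
  ... | inj₁ k<n = begin
    ∑ n f ∙ f n       ≈⟨ ∙-cong (∑-update n k f g x k<n (λ i i<n → f≈g i (ℕ.m<n⇒m<1+n i<n)) fk≈gk∙x)
                                (f≈g n ℕ.≤-refl (ℕ.>⇒≢ k<n)) ⟩
    (∑ n g ∙ x) ∙ g n ≈⟨ xy∙z≈xz∙y _ _ _ ⟩
    (∑ n g ∙ g n) ∙ x ∎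

  ∑-single : ∀ n k f → k < n → (∀ i → i < n → i ≢ k → f i ≈ ε) → ∑ n f ≈ f k
  ∑-single n k f k<n f≈ε = begin
    ∑ n f            ≈⟨ ∑-update n k f (λ _ → ε) (f k) k<n f≈ε (sym (identityˡ _)) ⟩
    ∑ n (λ _ → ε) ∙ f k ≈⟨ ∙-congʳ (∑-ε n (λ _ _ → refl)) ⟩
    ε ∙ f k          ≈⟨ identityˡ _ ⟩
    f k              ∎

  ∑-reverse : ∀ n f → ∑ n f ≈ ∑[ i < n ] f (n ∸ suc i)
  ∑-reverse zero    f = refl
  ∑-reverse (suc n) f = begin
    ∑ n f ∙ f n                          ≈⟨ ∙-congʳ (∑-reverse n f) ⟩
    ∑[ i < n ] f (n ∸ suc i) ∙ f n       ≈⟨ comm _ _ ⟩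
    f n ∙ ∑[ i < n ] f (n ∸ suc i)       ≈⟨ sym (∑-unfoldˡ n (λ i → f (suc n ∸ suc i))) ⟩
    ∑[ i < suc n ] f (suc n ∸ suc i)     ∎

  ∑-triangle : ∀ n (h : ℕ → ℕ → A) →
               ∑[ j < n ] ∑[ i < suc j ] h j i ≈ ∑[ i < n ] ∑[ k < n ∸ i ] h (i ℕ.+ k) i
  ∑-triangle zero    h = refl
  ∑-triangle (suc n) h = begin
    ∑[ j < n ] ∑[ i < suc j ] h j i ∙ (∑[ i < n ] h n i ∙ h n n)
      ≈⟨ ∙-congʳ (∑-triangle n h) ⟩
    ∑[ i < n ] ∑[ k < n ∸ i ] h (i ℕ.+ k) i ∙ (∑[ i < n ] h n i ∙ h n n)
      ≈⟨ sym (assoc _ _ _) ⟩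
    (∑[ i < n ] ∑[ k < n ∸ i ] h (i ℕ.+ k) i ∙ ∑[ i < n ] h n i) ∙ h n n
      ≈⟨ ∙-cong (sym (∑-distrib-∙ n _ _)) (reflexive (≡.cong (λ m → h m n) (≡.sym (ℕ.+-identityʳ n)))) ⟩
    ∑[ i < n ] (∑[ k < n ∸ i ] h (i ℕ.+ k) i ∙ h n i) ∙ h (n ℕ.+ 0) n
      ≈⟨ ∙-cong (∑-cong-< n extend) (sym (identityˡ _)) ⟩
    ∑[ i < n ] ∑[ k < suc n ∸ i ] h (i ℕ.+ k) i ∙ ∑[ k < 1 ] h (n ℕ.+ k) n
      ≈⟨ ∙-congˡ (∑-bound-≡ _ (≡.sym (ℕ.m+n∸n≡m 1 n))) ⟩
    ∑[ i < n ] ∑[ k < suc n ∸ i ] h (i ℕ.+ k) i ∙ ∑[ k < suc n ∸ n ] h (n ℕ.+ k) n ∎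
    where
    extend : ∀ i → i < n → ∑[ k < n ∸ i ] h (i ℕ.+ k) i ∙ h n i ≈ ∑[ k < suc n ∸ i ] h (i ℕ.+ k) i
    extend i i<n = begin
      ∑[ k < n ∸ i ] h (i ℕ.+ k) i ∙ h n i
        ≈⟨ ∙-congˡ (reflexive (≡.cong (λ m → h m i) (≡.sym (ℕ.m+[n∸m]≡n (ℕ.<⇒≤ i<n))))) ⟩
      ∑[ k < suc (n ∸ i) ] h (i ℕ.+ k) i
        ≈⟨ ∑-bound-≡ _ (≡.sym (ℕ.+-∸-assoc 1 (ℕ.<⇒≤ i<n))) ⟩
      ∑[ k < suc n ∸ i ] h (i ℕ.+ k) i ∎

  -- Both sides sum H i k l over the triples with i + k + l = n.
  ∑-antidiagonal-assoc : ∀ n (H : ℕ → ℕ → ℕ → A) →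
    ∑[ j < suc n ] ∑[ i < suc j ] H i (j ∸ i) (n ∸ j) ≈ ∑[ i < suc n ] ∑[ k < suc (n ∸ i) ] H i k (n ∸ i ∸ k)
  ∑-antidiagonal-assoc n H = trans (∑-triangle (suc n) (λ j i → H i (j ∸ i) (n ∸ j))) (∑-cong-< (suc n) reindex)
    where
    reindex : ∀ i → i < suc n → ∑[ k < suc n ∸ i ] H i (i ℕ.+ k ∸ i) (n ∸ (i ℕ.+ k))
                              ≈ ∑[ k < suc (n ∸ i) ] H i k (n ∸ i ∸ k)
    reindex i i<1+n = trans (∑-bound-≡ _ (ℕ.+-∸-assoc 1 (ℕ.≤-pred i<1+n)))
      (∑-cong (suc (n ∸ i)) (λ k → reflexive (≡.cong₂ (H i) (ℕ.m+n∸m≡n i k) (≡.sym (ℕ.∸-+-assoc n i k)))))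

  sumₗ : List A → A
  sumₗ = foldr _∙_ ε

  sumₗ-map-cong : ∀ {b} {B : Set b} xs {f g : B → A} → (∀ x → x ∈ xs → f x ≈ g x) →
                  sumₗ (map f xs) ≈ sumₗ (map g xs)
  sumₗ-map-cong []       f≈g = refl
  sumₗ-map-cong (x ∷ xs) f≈g = ∙-cong (f≈g x (here ≡.refl)) (sumₗ-map-cong xs (λ y y∈xs → f≈g y (there y∈xs)))

  sumₗ-map-∑ : ∀ {b} {B : Set b} xs n (f : B → ℕ → A) →
               sumₗ (map (λ x → ∑ n (f x)) xs) ≈ ∑[ i < n ] sumₗ (map (λ x → f x i) xs)
  sumₗ-map-∑ []       n f = sym (∑-ε n (λ _ _ → refl))
  sumₗ-map-∑ (x ∷ xs) n f = trans (∙-congˡ (sumₗ-map-∑ xs n f)) (sym (∑-distrib-∙ n _ _))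

  sumₗ-map-filter : ∀ {b p} {B : Set b} {P : Pred B p} (P? : Decidable P) xs (f : B → A) →
                    (∀ x → x ∈ xs → ¬ P x → f x ≈ ε) → sumₗ (map f xs) ≈ sumₗ (map f (filter P? xs))
  sumₗ-map-filter P? []       f f≈ε = refl
  sumₗ-map-filter P? (x ∷ xs) f f≈ε with P? x
  ... | yes _  = ∙-congˡ (sumₗ-map-filter P? xs f (λ y y∈xs → f≈ε y (there y∈xs)))
  ... | no ¬px = trans (∙-cong (f≈ε x (here ≡.refl) ¬px) (sumₗ-map-filter P? xs f (λ y y∈xs → f≈ε y (there y∈xs))))
                       (identityˡ _)

  foldr-applyUpTo : ∀ n (f : ℕ → A) g → foldr (λ i acc → f i ∙ acc) ε (applyUpTo g n) ≈ ∑[ i < n ] f (g i)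
  foldr-applyUpTo zero    f g = refl
  foldr-applyUpTo (suc n) f g =
    trans (∙-congˡ (foldr-applyUpTo n f (λ i → g (suc i)))) (sym (∑-unfoldˡ n (λ i → f (g i))))

module RingSum {c ℓ} (R : CommutativeRing c ℓ) where

  open CommutativeRing R
  open FiniteSum +-commutativeMonoid public
  open import Data.Fin using (toℕ)
  open import Algebra.Definitions.RawMonoid +-rawMonoid using (_×_) renaming (sum to sumᵛ)
  open import Algebra.Properties.Monoid.Mult +-monoid using (×-congʳ)
  open import Algebra.Properties.Semiring.Exp semiring using (_^_)
  import Algebra.Properties.CommutativeSemiring.Binomial commutativeSemiring as Binomial
  open import Relation.Binary.Reasoning.Setoid setoid

  *-distribˡ-∑ : ∀ n x f → x * ∑ n f ≈ ∑[ i < n ] (x * f i)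
  *-distribˡ-∑ zero    x f = zeroʳ x
  *-distribˡ-∑ (suc n) x f = trans (distribˡ x _ _) (+-congʳ (*-distribˡ-∑ n x f))

  *-distribʳ-∑ : ∀ n x f → ∑ n f * x ≈ ∑[ i < n ] (f i * x)
  *-distribʳ-∑ n x f = trans (*-comm _ _) (trans (*-distribˡ-∑ n x f) (∑-cong n (λ i → *-comm _ _)))

  *-distribˡ-sumₗ : ∀ {b} {B : Set b} xs x (f : B → Carrier) →
                    x * sumₗ (map f xs) ≈ sumₗ (map (λ y → x * f y) xs)
  *-distribˡ-sumₗ []       x f = zeroʳ x
  *-distribˡ-sumₗ (y ∷ xs) x f = trans (distribˡ x _ _) (+-congˡ (*-distribˡ-sumₗ xs x f))

  sumᵛ-≈-∑ : ∀ n (f : ℕ → Carrier) → sumᵛ {n} (λ k → f (toℕ k)) ≈ ∑ n f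
  sumᵛ-≈-∑ zero    f = refl
  sumᵛ-≈-∑ (suc n) f = trans (+-congˡ (sumᵛ-≈-∑ n (λ k → f (suc k)))) (sym (∑-unfoldˡ n f))

  1#^≈1# : ∀ j → 1# ^ j ≈ 1#
  1#^≈1# zero    = refl
  1#^≈1# (suc j) = trans (*-identityˡ _) (1#^≈1# j)

  binomial-+1 : ∀ x m → (x + 1#) ^ m ≈ ∑[ k < suc m ] ((m C k) × x ^ k)
  binomial-+1 x m = begin
    (x + 1#) ^ m
      ≈⟨ Binomial.theorem m x 1# ⟩
    sumᵛ {suc m} (λ k → (m C toℕ k) × (x ^ toℕ k * 1# ^ (m ∸ toℕ k)))
      ≈⟨ sumᵛ-≈-∑ (suc m) (λ k → (m C k) × (x ^ k * 1# ^ (m ∸ k))) ⟩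
    ∑[ k < suc m ] ((m C k) × (x ^ k * 1# ^ (m ∸ k)))
      ≈⟨ ∑-cong (suc m) (λ k → ×-congʳ (m C k) (trans (*-congˡ (1#^≈1# (m ∸ k))) (*-identityʳ _))) ⟩
    ∑[ k < suc m ] ((m C k) × x ^ k) ∎

module RationalFacts where

  open ≡ using (cong; cong₂)
  open ≡.≡-Reasoning
  open import Data.Integer as ℤ using (+_)
  import Data.Integer.Properties as ℤ
  open import Data.Rational.Unnormalised as ℚᵘ using (mkℚᵘ; *≡*)
  import Data.Rational.Unnormalised.Properties as ℚᵘ
  open import Algebra.Properties.CommutativeSemigroup (CommutativeRing.*-commutativeSemigroup ℚ.+-*-commutativeRing) using (interchange)

  -- ℕtoℚ k and recip (suc k) are definitionally fromℚᵘ (k / 1) and fromℚᵘ (1 / suc k),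
  -- so their arithmetic is transported from the unnormalised rationals.

  fromℚᵘ-homo-+ : ∀ p q → fromℚᵘ (p ℚᵘ.+ q) ≡ fromℚᵘ p ℚ.+ fromℚᵘ q
  fromℚᵘ-homo-+ p q = ℚ.toℚᵘ-injective (ℚᵘ.≃-trans (ℚ.toℚᵘ-fromℚᵘ (p ℚᵘ.+ q))
    (ℚᵘ.≃-trans (ℚᵘ.+-cong (ℚᵘ.≃-sym (ℚ.toℚᵘ-fromℚᵘ p)) (ℚᵘ.≃-sym (ℚ.toℚᵘ-fromℚᵘ q)))
                (ℚᵘ.≃-sym (ℚ.toℚᵘ-homo-+ (fromℚᵘ p) (fromℚᵘ q)))))

  fromℚᵘ-homo-* : ∀ p q → fromℚᵘ (p ℚᵘ.* q) ≡ fromℚᵘ p ℚ.* fromℚᵘ q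
  fromℚᵘ-homo-* p q = ℚ.toℚᵘ-injective (ℚᵘ.≃-trans (ℚ.toℚᵘ-fromℚᵘ (p ℚᵘ.* q))
    (ℚᵘ.≃-trans (ℚᵘ.*-cong (ℚᵘ.≃-sym (ℚ.toℚᵘ-fromℚᵘ p)) (ℚᵘ.≃-sym (ℚ.toℚᵘ-fromℚᵘ q)))
                (ℚᵘ.≃-sym (ℚ.toℚᵘ-homo-* (fromℚᵘ p) (fromℚᵘ q)))))

  ℕtoℚ-homo-+ : ∀ m n → ℕtoℚ (m ℕ.+ n) ≡ ℕtoℚ m ℚ.+ ℕtoℚ n
  ℕtoℚ-homo-+ m n = ≡.trans
    (ℚ.fromℚᵘ-cong {mkℚᵘ (+ (m ℕ.+ n)) 0} {mkℚᵘ (+ m) 0 ℚᵘ.+ mkℚᵘ (+ n) 0}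
                   (*≡* (cong (ℤ._* + 1) m+n≡m*1+n*1)))
    (fromℚᵘ-homo-+ (mkℚᵘ (+ m) 0) (mkℚᵘ (+ n) 0))
    where
    m+n≡m*1+n*1 : + (m ℕ.+ n) ≡ + m ℤ.* + 1 ℤ.+ + n ℤ.* + 1
    m+n≡m*1+n*1 = ≡.trans (ℤ.pos-+ m n) (≡.sym (cong₂ ℤ._+_ (ℤ.*-identityʳ (+ m)) (ℤ.*-identityʳ (+ n))))

  ℕtoℚ-homo-* : ∀ m n → ℕtoℚ (m ℕ.* n) ≡ ℕtoℚ m ℚ.* ℕtoℚ n
  ℕtoℚ-homo-* m n = ≡.trans
    (ℚ.fromℚᵘ-cong {mkℚᵘ (+ (m ℕ.* n)) 0} {mkℚᵘ (+ m) 0 ℚᵘ.* mkℚᵘ (+ n) 0}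
                   (*≡* (cong (ℤ._* + 1) (ℤ.pos-* m n))))
    (fromℚᵘ-homo-* (mkℚᵘ (+ m) 0) (mkℚᵘ (+ n) 0))

  recip-inverseˡ : ∀ k → recip (suc k) ℚ.* ℕtoℚ (suc k) ≡ 1ℚ
  recip-inverseˡ k = ≡.trans
    (≡.sym (fromℚᵘ-homo-* (mkℚᵘ (+ 1) k) (mkℚᵘ (+ suc k) 0)))
    (ℚ.fromℚᵘ-cong {mkℚᵘ (+ 1) k ℚᵘ.* mkℚᵘ (+ suc k) 0} {mkℚᵘ (+ 1) 0} (*≡* cross))
    where
    cross : (+ 1 ℤ.* + suc k) ℤ.* + 1 ≡ + 1 ℤ.* + (suc k ℕ.* 1)
    cross = ≡.trans (ℤ.*-identityʳ _) (cong (λ m → + 1 ℤ.* + m) (≡.sym (ℕ.*-identityʳ (suc k))))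

  recip-unique : ∀ x k → x ℚ.* ℕtoℚ (suc k) ≡ 1ℚ → x ≡ recip (suc k)
  recip-unique x k x*k≡1 = begin
    x                                ≡⟨ ℚ.*-identityʳ x ⟨
    x ℚ.* 1ℚ                         ≡⟨ cong (x ℚ.*_) (≡.trans (ℚ.*-comm (ℕtoℚ (suc k)) r) (recip-inverseˡ k)) ⟨
    x ℚ.* (ℕtoℚ (suc k) ℚ.* r)       ≡⟨ ℚ.*-assoc x (ℕtoℚ (suc k)) r ⟨
    (x ℚ.* ℕtoℚ (suc k)) ℚ.* r       ≡⟨ cong (ℚ._* r) x*k≡1 ⟩
    1ℚ ℚ.* r                         ≡⟨ ℚ.*-identityˡ r ⟩
    r                                ∎
    where r = recip (suc k)

  recip-homo-* : ∀ m n → recip (suc m ℕ.* suc n) ≡ recip (suc m) ℚ.* recip (suc n)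
  recip-homo-* m n = ≡.sym (recip-unique (r ℚ.* s) (n ℕ.+ m ℕ.* suc n) (begin
    (r ℚ.* s) ℚ.* ℕtoℚ (suc m ℕ.* suc n)            ≡⟨ cong ((r ℚ.* s) ℚ.*_) (ℕtoℚ-homo-* (suc m) (suc n)) ⟩
    (r ℚ.* s) ℚ.* (ℕtoℚ (suc m) ℚ.* ℕtoℚ (suc n))   ≡⟨ interchange r s (ℕtoℚ (suc m)) (ℕtoℚ (suc n)) ⟩
    (r ℚ.* ℕtoℚ (suc m)) ℚ.* (s ℚ.* ℕtoℚ (suc n))   ≡⟨ cong₂ ℚ._*_ (recip-inverseˡ m) (recip-inverseˡ n) ⟩
    1ℚ ℚ.* 1ℚ                                       ≡⟨ ℚ.*-identityˡ 1ℚ ⟩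
    1ℚ                                              ∎))
    where
    r = recip (suc m)
    s = recip (suc n)

module PolyRing where

  open ≡ using (refl; cong; cong₂)
  open ≡.≡-Reasoning
  open import Relation.Binary.Structures using (IsEquivalence)
  open RingSum ℚ.+-*-commutativeRing

  coeff-⊛ : ∀ p q a b → (p ⊛ q) a b ≡ ∑[ i < suc a ] ∑[ j < suc b ] (p i j ℚ.* q (a ∸ i) (b ∸ j))
  coeff-⊛ p q a b = ≡.trans (foldr-applyUpTo (suc a) _ (λ i → i))
                            (∑-cong (suc a) (λ i → foldr-applyUpTo (suc b) _ (λ j → j)))

  ⊛-cong : ∀ {p p′ q q′} → p ≐ p′ → q ≐ q′ → (p ⊛ q) ≐ (p′ ⊛ q′)
  ⊛-cong {p} {p′} {q} {q′} p≐p′ q≐q′ a b = begin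
    (p ⊛ q) a b
      ≡⟨ coeff-⊛ p q a b ⟩
    ∑[ i < suc a ] ∑[ j < suc b ] (p i j ℚ.* q (a ∸ i) (b ∸ j))
      ≡⟨ ∑-cong (suc a) (λ i → ∑-cong (suc b) (λ j → cong₂ ℚ._*_ (p≐p′ i j) (q≐q′ (a ∸ i) (b ∸ j)))) ⟩
    ∑[ i < suc a ] ∑[ j < suc b ] (p′ i j ℚ.* q′ (a ∸ i) (b ∸ j))
      ≡⟨ coeff-⊛ p′ q′ a b ⟨
    (p′ ⊛ q′) a b   ∎

  ⊛-congˡ : ∀ p {q q′} → q ≐ q′ → (p ⊛ q) ≐ (p ⊛ q′)
  ⊛-congˡ p q≐q′ = ⊛-cong {p} {p} (λ a b → refl) q≐q′

  ⊛-congʳ : ∀ q {p p′} → p ≐ p′ → (p ⊛ q) ≐ (p′ ⊛ q)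
  ⊛-congʳ q p≐p′ = ⊛-cong p≐p′ (λ a b → refl {x = q a b})

  ⊕-congˡ : ∀ p {q q′} → q ≐ q′ → (p ⊕ q) ≐ (p ⊕ q′)
  ⊕-congˡ p q≐q′ a b = cong (p a b ℚ.+_) (q≐q′ a b)

  ⊕-congʳ : ∀ q {p p′} → p ≐ p′ → (p ⊕ q) ≐ (p′ ⊕ q)
  ⊕-congʳ q p≐p′ a b = cong (ℚ._+ q a b) (p≐p′ a b)

  ⊛-comm : ∀ p q → (p ⊛ q) ≐ (q ⊛ p)
  ⊛-comm p q a b = begin
    (p ⊛ q) a b
      ≡⟨ coeff-⊛ p q a b ⟩
    ∑[ i < suc a ] ∑[ j < suc b ] (p i j ℚ.* q (a ∸ i) (b ∸ j))
      ≡⟨ ≡.trans (∑-reverse (suc a) _) (∑-cong (suc a) (λ i → ∑-reverse (suc b) _)) ⟩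
    ∑[ i < suc a ] ∑[ j < suc b ] (p (a ∸ i) (b ∸ j) ℚ.* q (a ∸ (a ∸ i)) (b ∸ (b ∸ j)))
      ≡⟨ ∑-cong-< (suc a) (λ i i≤a → ∑-cong-< (suc b) (λ j j≤b → ≡.trans (ℚ.*-comm (p (a ∸ i) (b ∸ j)) _)
           (cong₂ (λ i′ j′ → q i′ j′ ℚ.* p (a ∸ i) (b ∸ j))
                  (ℕ.m∸[m∸n]≡n (ℕ.≤-pred i≤a)) (ℕ.m∸[m∸n]≡n (ℕ.≤-pred j≤b))))) ⟩
    ∑[ i < suc a ] ∑[ j < suc b ] (q i j ℚ.* p (a ∸ i) (b ∸ j))
      ≡⟨ coeff-⊛ q p a b ⟨
    (q ⊛ p) a b ∎

  private
    tripleSum : Poly → Poly → Poly → ℕ → ℕ → ℚ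
    tripleSum p q r a b = ∑[ i < suc a ] ∑[ j < suc b ] ∑[ k < suc (a ∸ i) ] ∑[ l < suc (b ∸ j) ]
                            (p i j ℚ.* q k l ℚ.* r (a ∸ i ∸ k) (b ∸ j ∸ l))

    ⊛-assocʳ-tripleSum : ∀ p q r a b → (p ⊛ (q ⊛ r)) a b ≡ tripleSum p q r a b
    ⊛-assocʳ-tripleSum p q r a b = begin
      (p ⊛ (q ⊛ r)) a b
        ≡⟨ coeff-⊛ p (q ⊛ r) a b ⟩
      ∑[ i < suc a ] ∑[ j < suc b ] (p i j ℚ.* (q ⊛ r) (a ∸ i) (b ∸ j))
        ≡⟨ ∑-cong (suc a) (λ i → ∑-cong (suc b) (λ j → ≡.trans (cong (p i j ℚ.*_) (coeff-⊛ q r (a ∸ i) (b ∸ j)))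
             (≡.trans (*-distribˡ-∑ (suc (a ∸ i)) (p i j) _)
                      (∑-cong (suc (a ∸ i)) (λ k → *-distribˡ-∑ (suc (b ∸ j)) (p i j) _))))) ⟩
      ∑[ i < suc a ] ∑[ j < suc b ] ∑[ k < suc (a ∸ i) ] ∑[ l < suc (b ∸ j) ]
        (p i j ℚ.* (q k l ℚ.* r (a ∸ i ∸ k) (b ∸ j ∸ l)))
        ≡⟨ ∑-cong (suc a) (λ i → ∑-cong (suc b) (λ j → ∑-cong (suc (a ∸ i)) (λ k → ∑-cong (suc (b ∸ j)) (λ l →
             ≡.sym (ℚ.*-assoc (p i j) (q k l) _))))) ⟩
      tripleSum p q r a b ∎

    ⊛-assocˡ-tripleSum : ∀ p q r a b → ((p ⊛ q) ⊛ r) a b ≡ tripleSum p q r a b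
    ⊛-assocˡ-tripleSum p q r a b = begin
      ((p ⊛ q) ⊛ r) a b
        ≡⟨ coeff-⊛ (p ⊛ q) r a b ⟩
      ∑[ i < suc a ] ∑[ j < suc b ] ((p ⊛ q) i j ℚ.* r (a ∸ i) (b ∸ j))
        ≡⟨ ∑-cong (suc a) (λ i → ∑-cong (suc b) (λ j → ≡.trans (cong (ℚ._* r (a ∸ i) (b ∸ j)) (coeff-⊛ p q i j))
             (≡.trans (*-distribʳ-∑ (suc i) _ _) (∑-cong (suc i) (λ i′ → *-distribʳ-∑ (suc j) _ _))))) ⟩
      ∑[ i < suc a ] ∑[ j < suc b ] ∑[ i′ < suc i ] ∑[ j′ < suc j ] (p i′ j′ ℚ.* q (i ∸ i′) (j ∸ j′) ℚ.* r (a ∸ i) (b ∸ j))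
        ≡⟨ ∑-cong (suc a) (λ i → ∑-comm (suc b) (suc i) _) ⟩
      ∑[ i < suc a ] ∑[ i′ < suc i ] ∑[ j < suc b ] ∑[ j′ < suc j ] (p i′ j′ ℚ.* q (i ∸ i′) (j ∸ j′) ℚ.* r (a ∸ i) (b ∸ j))
        ≡⟨ ∑-cong (suc a) (λ i → ∑-cong (suc i) (λ i′ →
             ∑-antidiagonal-assoc b (λ j′ l m → p i′ j′ ℚ.* q (i ∸ i′) l ℚ.* r (a ∸ i) m))) ⟩
      ∑[ i < suc a ] ∑[ i′ < suc i ] ∑[ j′ < suc b ] ∑[ l < suc (b ∸ j′) ] (p i′ j′ ℚ.* q (i ∸ i′) l ℚ.* r (a ∸ i) (b ∸ j′ ∸ l))
        ≡⟨ ∑-antidiagonal-assoc a (λ i′ k m → ∑[ j′ < suc b ] ∑[ l < suc (b ∸ j′) ] (p i′ j′ ℚ.* q k l ℚ.* r m (b ∸ j′ ∸ l))) ⟩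
      ∑[ i < suc a ] ∑[ k < suc (a ∸ i) ] ∑[ j < suc b ] ∑[ l < suc (b ∸ j) ] (p i j ℚ.* q k l ℚ.* r (a ∸ i ∸ k) (b ∸ j ∸ l))
        ≡⟨ ∑-cong (suc a) (λ i → ∑-comm (suc (a ∸ i)) (suc b) _) ⟩
      tripleSum p q r a b ∎

  ⊛-assoc : ∀ p q r → ((p ⊛ q) ⊛ r) ≐ (p ⊛ (q ⊛ r))
  ⊛-assoc p q r a b = ≡.trans (⊛-assocˡ-tripleSum p q r a b) (≡.sym (⊛-assocʳ-tripleSum p q r a b))

  ⊛-distribˡ : ∀ p q r → (p ⊛ (q ⊕ r)) ≐ ((p ⊛ q) ⊕ (p ⊛ r))
  ⊛-distribˡ p q r a b = begin
    (p ⊛ (q ⊕ r)) a b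
      ≡⟨ coeff-⊛ p (q ⊕ r) a b ⟩
    ∑[ i < suc a ] ∑[ j < suc b ] (p i j ℚ.* (q (a ∸ i) (b ∸ j) ℚ.+ r (a ∸ i) (b ∸ j)))
      ≡⟨ ∑-cong (suc a) (λ i → ≡.trans (∑-cong (suc b) (λ j → ℚ.*-distribˡ-+ (p i j) _ _))
                                       (∑-distrib-∙ (suc b) _ _)) ⟩
    ∑[ i < suc a ] (∑[ j < suc b ] (p i j ℚ.* q (a ∸ i) (b ∸ j)) ℚ.+ ∑[ j < suc b ] (p i j ℚ.* r (a ∸ i) (b ∸ j)))
      ≡⟨ ∑-distrib-∙ (suc a) _ _ ⟩
    _ ≡⟨ cong₂ ℚ._+_ (coeff-⊛ p q a b) (coeff-⊛ p r a b) ⟨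
    ((p ⊛ q) ⊕ (p ⊛ r)) a b ∎

  cst-⊛ : ∀ c p → (cst c ⊛ p) ≐ (c · p)
  cst-⊛ c p a b = begin
    (cst c ⊛ p) a b
      ≡⟨ coeff-⊛ (cst c) p a b ⟩
    ∑[ i < suc a ] ∑[ j < suc b ] (cst c i j ℚ.* p (a ∸ i) (b ∸ j))
      ≡⟨ ∑-single (suc a) 0 _ (s≤s z≤n) (λ { zero _ 0≢0 → ⊥-elim (0≢0 refl)
                                          ; (suc i) _ _ → ∑-ε (suc b) (λ j _ → ℚ.*-zeroˡ (p (a ∸ suc i) (b ∸ j))) }) ⟩
    ∑[ j < suc b ] (cst c 0 j ℚ.* p a (b ∸ j))
      ≡⟨ ∑-single (suc b) 0 _ (s≤s z≤n) (λ { zero _ 0≢0 → ⊥-elim (0≢0 refl)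
                                          ; (suc j) _ _ → ℚ.*-zeroˡ (p a (b ∸ suc j)) }) ⟩
    (c · p) a b ∎

  ⊛-identityˡ : ∀ p → (1P ⊛ p) ≐ p
  ⊛-identityˡ p a b = ≡.trans (cst-⊛ 1ℚ p a b) (ℚ.*-identityˡ (p a b))

  ⊛-identityʳ : ∀ p → (p ⊛ 1P) ≐ p
  ⊛-identityʳ p a b = ≡.trans (⊛-comm p 1P a b) (⊛-identityˡ p a b)

  ⊛-distribʳ : ∀ p q r → ((q ⊕ r) ⊛ p) ≐ ((q ⊛ p) ⊕ (r ⊛ p))
  ⊛-distribʳ p q r a b = ≡.trans (⊛-comm (q ⊕ r) p a b)
    (≡.trans (⊛-distribˡ p q r a b) (cong₂ ℚ._+_ (⊛-comm p q a b) (⊛-comm p r a b)))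

  ≐-isEquivalence : IsEquivalence _≐_
  ≐-isEquivalence = record
    { refl  = λ a b → refl
    ; sym   = λ p≐q a b → ≡.sym (p≐q a b)
    ; trans = λ p≐q q≐r a b → ≡.trans (p≐q a b) (q≐r a b)
    }

  commutativeRing : CommutativeRing 0ℓ 0ℓ
  commutativeRing = record
    { Carrier = Poly ; _≈_ = _≐_ ; _+_ = _⊕_ ; _*_ = _⊛_ ; -_ = ⊝_ ; 0# = 0P ; 1# = 1P
    ; isCommutativeRing = record
      { isRing = record
        { +-isAbelianGroup = record
          { isGroup = record
            { isMonoid = record
              { isSemigroup = record
                { isMagma = record
                  { isEquivalence = ≐-isEquivalence
                  ; ∙-cong = λ p≐p′ q≐q′ a b → cong₂ ℚ._+_ (p≐p′ a b) (q≐q′ a b) }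
                ; assoc = λ p q r a b → ℚ.+-assoc (p a b) (q a b) (r a b) }
              ; identity = (λ p a b → ℚ.+-identityˡ (p a b)) , (λ p a b → ℚ.+-identityʳ (p a b)) }
            ; inverse = (λ p a b → ℚ.+-inverseˡ (p a b)) , (λ p a b → ℚ.+-inverseʳ (p a b))
            ; ⁻¹-cong = λ p≐q a b → cong ℚ.-_ (p≐q a b) }
          ; comm = λ p q a b → ℚ.+-comm (p a b) (q a b) }
        ; *-cong = ⊛-cong
        ; *-assoc = ⊛-assoc
        ; *-identity = ⊛-identityˡ , ⊛-identityʳ
        ; distrib = ⊛-distribˡ , ⊛-distribʳ }
      ; *-comm = ⊛-comm } }

  module R = CommutativeRing commutativeRing

module PolyConstants where

  open ≡ using (refl; cong)
  open import Data.Nat using (_+_; _*_)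
  open PolyRing
  open import Algebra.Definitions.RawMonoid R.+-rawMonoid using (_×_)
  open import Algebra.Properties.CommutativeSemigroup R.*-commutativeSemigroup using (x∙yz≈y∙xz)
  open import Algebra.Solver.Ring.NaturalCoefficients.Default R.commutativeSemiring
  open import Relation.Binary.Reasoning.Setoid R.setoid

  natP : ℕ → Poly
  natP k = cst (ℕtoℚ k)

  recipP : ℕ → Poly
  recipP k = cst (recip k)

  cst-cong : ∀ {x y} → x ≡ y → cst x ≐ cst y
  cst-cong refl = R.refl

  cst-homo-+ : ∀ x y → cst (x ℚ.+ y) ≐ (cst x ⊕ cst y)
  cst-homo-+ x y zero    zero    = refl
  cst-homo-+ x y zero    (suc b) = ≡.sym (ℚ.+-identityˡ 0ℚ)
  cst-homo-+ x y (suc a) b       = ≡.sym (ℚ.+-identityˡ 0ℚ)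

  cst-homo-* : ∀ x y → cst (x ℚ.* y) ≐ (cst x ⊛ cst y)
  cst-homo-* x y zero    zero    = ≡.sym (cst-⊛ x (cst y) zero zero)
  cst-homo-* x y zero    (suc b) = ≡.sym (≡.trans (cst-⊛ x (cst y) zero (suc b)) (ℚ.*-zeroʳ x))
  cst-homo-* x y (suc a) b       = ≡.sym (≡.trans (cst-⊛ x (cst y) (suc a) b) (ℚ.*-zeroʳ x))

  ·-≐-cst-⊛ : ∀ c p → (c · p) ≐ (cst c ⊛ p)
  ·-≐-cst-⊛ c p = R.sym (cst-⊛ c p)

  natP-0 : natP 0 ≐ 0P
  natP-0 zero    zero    = refl
  natP-0 zero    (suc b) = refl
  natP-0 (suc a) b       = refl

  natP-homo-+ : ∀ m n → natP (m ℕ.+ n) ≐ (natP m ⊕ natP n)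
  natP-homo-+ m n = R.trans (cst-cong (RationalFacts.ℕtoℚ-homo-+ m n)) (cst-homo-+ (ℕtoℚ m) (ℕtoℚ n))

  natP-homo-* : ∀ m n → natP (m ℕ.* n) ≐ (natP m ⊛ natP n)
  natP-homo-* m n = R.trans (cst-cong (RationalFacts.ℕtoℚ-homo-* m n)) (cst-homo-* (ℕtoℚ m) (ℕtoℚ n))

  ×-≐-natP-⊛ : ∀ k p → (k × p) ≐ (natP k ⊛ p)
  ×-≐-natP-⊛ zero    p = R.sym (R.trans (⊛-congʳ p natP-0) (R.zeroˡ p))
  ×-≐-natP-⊛ (suc k) p = begin
    p ⊕ (k × p)                 ≈⟨ R.+-cong (R.sym (R.*-identityˡ p)) (×-≐-natP-⊛ k p) ⟩
    (natP 1 ⊛ p) ⊕ (natP k ⊛ p) ≈⟨ R.distribʳ p (natP 1) (natP k) ⟨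
    (natP 1 ⊕ natP k) ⊛ p       ≈⟨ ⊛-congʳ p (natP-homo-+ 1 k) ⟨
    natP (suc k) ⊛ p            ∎

  recipP-inverseˡ : ∀ k → (recipP (suc k) ⊛ natP (suc k)) ≐ 1P
  recipP-inverseˡ k = R.trans (R.sym (cst-homo-* (recip (suc k)) (ℕtoℚ (suc k)))) (cst-cong (RationalFacts.recip-inverseˡ k))

  recipP-cancelˡ : ∀ k p → (recipP (suc k) ⊛ (natP (suc k) ⊛ p)) ≐ p
  recipP-cancelˡ k p = R.trans (R.sym (R.*-assoc (recipP (suc k)) (natP (suc k)) p))
    (R.trans (⊛-congʳ p (recipP-inverseˡ k)) (R.*-identityˡ p))

  recipP-homo-* : ∀ m n → recipP (suc m ℕ.* suc n) ≐ (recipP (suc m) ⊛ recipP (suc n))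
  recipP-homo-* m n = R.trans (cst-cong (RationalFacts.recip-homo-* m n)) (cst-homo-* (recip (suc m)) (recip (suc n)))

  natP-recipP-cancelˡ : ∀ k p → (natP (suc k) ⊛ (recipP (suc k) ⊛ p)) ≐ p
  natP-recipP-cancelˡ k p = R.trans (R.sym (R.*-assoc (natP (suc k)) (recipP (suc k)) p))
    (R.trans (⊛-congʳ p (R.trans (R.*-comm (natP (suc k)) (recipP (suc k))) (recipP-inverseˡ k))) (R.*-identityˡ p))

  recipP-*-cancel-natP : ∀ z b m → 1 ≤ z → 1 ≤ b → 1 ≤ m → (recipP (z * (b * m)) ⊛ natP m) ≐ (recipP z ⊛ recipP b)
  recipP-*-cancel-natP (suc z) (suc b) (suc m) _ _ _ = begin
    recipP (suc z * (suc b * suc m)) ⊛ natP (suc m)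
      ≈⟨ ⊛-congʳ (natP (suc m)) (R.trans (recipP-homo-* z (m + b * suc m)) (⊛-congˡ (recipP (suc z)) (recipP-homo-* b m))) ⟩
    (recipP (suc z) ⊛ (recipP (suc b) ⊛ recipP (suc m))) ⊛ natP (suc m)
      ≈⟨ solve 4 (λ Z B M N → (Z :* (B :* M)) :* N := (Z :* B) :* (M :* N)) R.refl
               (recipP (suc z)) (recipP (suc b)) (recipP (suc m)) (natP (suc m)) ⟩
    (recipP (suc z) ⊛ recipP (suc b)) ⊛ (recipP (suc m) ⊛ natP (suc m))
      ≈⟨ R.trans (⊛-congˡ (recipP (suc z) ⊛ recipP (suc b)) (recipP-inverseˡ m)) (R.*-identityʳ _) ⟩
    recipP (suc z) ⊛ recipP (suc b) ∎

  recipP-natP-cross : ∀ a b x y → suc a * x ≡ suc b * y → (recipP (suc b) ⊛ natP x) ≐ (recipP (suc a) ⊛ natP y)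
  recipP-natP-cross a b x y a′x≡b′y = begin
    rb ⊛ natP x                                 ≈⟨ ⊛-congˡ rb (recipP-cancelˡ a (natP x)) ⟨
    rb ⊛ (ra ⊛ (natP (suc a) ⊛ natP x))         ≈⟨ ⊛-congˡ rb (⊛-congˡ ra (R.trans (R.sym (natP-homo-* (suc a) x))
                                                     (R.trans (cst-cong (cong ℕtoℚ a′x≡b′y)) (natP-homo-* (suc b) y)))) ⟩
    rb ⊛ (ra ⊛ (natP (suc b) ⊛ natP y))         ≈⟨ x∙yz≈y∙xz rb ra _ ⟩
    ra ⊛ (rb ⊛ (natP (suc b) ⊛ natP y))         ≈⟨ ⊛-congˡ ra (recipP-cancelˡ b (natP y)) ⟩
    ra ⊛ natP y                                 ∎
    where
    ra = recipP (suc a)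
    rb = recipP (suc b)

module DescendingLists where

  open ≡ using (refl)

  remove : ℕ → List ℕ → List ℕ
  remove b []       = []
  remove b (x ∷ xs) with x ≟ b
  ... | yes _ = xs
  ... | no  _ = x ∷ remove b xs

  remove-↭ : ∀ {b xs} → b ∈ xs → xs ↭ b ∷ remove b xs
  remove-↭ {b} {x ∷ xs} b∈x∷xs with x ≟ b
  ... | yes refl = ↭-refl
  ... | no  x≢b  = ↭-trans (↭-prep x (remove-↭ (Any.tail (λ b≡x → x≢b (≡.sym b≡x)) b∈x∷xs))) (↭-swap x b ↭-refl)

  remove-All : ∀ {p} {P : ℕ → Set p} {b xs} → All P xs → All P (remove b xs)
  remove-All {b = b} {x ∷ xs} (px ∷ pxs) with x ≟ b
  ... | yes _ = pxs
  ... | no  _ = px ∷ remove-All pxs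
  remove-All {xs = []} [] = []

  remove-AllPairs : ∀ {r} {R : ℕ → ℕ → Set r} {b xs} → AllPairs R xs → AllPairs R (remove b xs)
  remove-AllPairs {xs = []} [] = []
  remove-AllPairs {b = b} {x ∷ xs} (rx ∷ rxs) with x ≟ b
  ... | yes _ = rxs
  ... | no  _ = remove-All rx ∷ remove-AllPairs rxs

  remove-↘ : ∀ {b xs} → Linked _≥_ xs → Linked _≥_ (remove b xs)
  remove-↘ xs↘ = AllPairs⇒Linked (remove-AllPairs (Linked⇒AllPairs ≥-trans xs↘))

  ↘-↭⇒≡ : ∀ {xs ys} → Linked _≥_ xs → Linked _≥_ ys → xs ↭ ys → xs ≡ ys
  ↘-↭⇒≡ xs↘ ys↘ xs↭ys = Pointwise-≡⇒≡ (↗↭↗⇒≋ ≥-totalOrder xs↘ ys↘ (↭⇒↭ₛ xs↭ys))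

  sortDesc : List ℕ → List ℕ
  sortDesc = ≥-Sort.sort

  sortDesc-↘ : ∀ xs → Linked _≥_ (sortDesc xs)
  sortDesc-↘ = ≥-Sort.sort-↗

  sortDesc-↭ : ∀ xs → sortDesc xs ↭ xs
  sortDesc-↭ = ≥-Sort.sort-↭

  sortDesc-∋ : ∀ b xs → b ∈ sortDesc (b ∷ xs)
  sortDesc-∋ b xs = Any-resp-↭ (↭-sym (sortDesc-↭ (b ∷ xs))) (here refl)

  remove-sortDesc : ∀ {b xs} → Linked _≥_ xs → remove b (sortDesc (b ∷ xs)) ≡ xs
  remove-sortDesc {b} {xs} xs↘ = ↘-↭⇒≡ (remove-↘ (sortDesc-↘ (b ∷ xs))) xs↘
    (drop-∷ (↭-trans (↭-sym (remove-↭ (sortDesc-∋ b xs))) (sortDesc-↭ (b ∷ xs))))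

  remove-injective : ∀ {b xs ys} → Linked _≥_ xs → Linked _≥_ ys → b ∈ xs → b ∈ ys →
                     remove b xs ≡ remove b ys → xs ≡ ys
  remove-injective {b} {xs} {ys} xs↘ ys↘ b∈xs b∈ys eq =
    ↘-↭⇒≡ xs↘ ys↘ (↭-trans (remove-↭ b∈xs)
                           (≡.subst (λ zs → b ∷ zs ↭ ys) (≡.sym eq) (↭-sym (remove-↭ b∈ys))))

  ∈⇒≤sum : ∀ {p μ} → p ∈ μ → p ≤ sum μ
  ∈⇒≤sum {μ = x ∷ xs} (here refl)  = ℕ.m≤m+n x (sum xs)
  ∈⇒≤sum {μ = x ∷ xs} (there p∈xs) = ℕ.≤-trans (∈⇒≤sum p∈xs) (ℕ.m≤n+m (sum xs) x)

module Multiplicity where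

  open ≡ using (refl; cong)

  mult-↭ : ∀ i {xs ys} → xs ↭ ys → mult i xs ≡ mult i ys
  mult-↭ i xs↭ys = ↭-length (filter-↭ (_≟ i) xs↭ys)

  mult-∷-≡ : ∀ b xs → mult b (b ∷ xs) ≡ suc (mult b xs)
  mult-∷-≡ b xs = cong length (List.filter-accept (_≟ b) {b} {xs} refl)

  mult-∷-≢ : ∀ {x i} xs → x ≢ i → mult i (x ∷ xs) ≡ mult i xs
  mult-∷-≢ {x} xs x≢i = cong length (List.filter-reject (_≟ _) {x} {xs} x≢i)

  mult-∉ : ∀ {b xs} → b ∉ xs → mult b xs ≡ 0
  mult-∉ {b} {xs} b∉xs =
    cong length (List.filter-none (_≟ b) (All.map (λ b≢x x≡b → b≢x (≡.sym x≡b)) (¬Any⇒All¬ xs b∉xs)))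
    where open import Data.List.Relation.Unary.All.Properties using (¬Any⇒All¬)

module MultiplicitySum {c ℓ} (M : CommutativeMonoid c ℓ) where

  open CommutativeMonoid M
  open FiniteSum M
  open import Algebra.Definitions.RawMonoid rawMonoid using (_×_)
  open Multiplicity

  sumₗ-map-mult : ∀ n (f : ℕ → Carrier) {μ} → All (1 ≤_) μ → All (_≤ n) μ →
                  sumₗ (map f μ) ≈ ∑[ c < n ] (mult (suc c) μ × f (suc c))
  sumₗ-map-mult n f {[]}         []              []           = sym (∑-ε n (λ _ _ → refl))
  sumₗ-map-mult n f {suc k ∷ xs} (s≤s z≤n ∷ xs>0) (x≤n ∷ xs≤n) = sym (trans
    (∑-update n k _ _ (f (suc k)) x≤n sameTerm newTerm)
    (trans (comm _ _) (∙-congˡ (sym (sumₗ-map-mult n f xs>0 xs≤n)))))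
    where
    sameTerm : ∀ c → c < n → c ≢ k → mult (suc c) (suc k ∷ xs) × f (suc c) ≈ mult (suc c) xs × f (suc c)
    sameTerm c _ c≢k =
      reflexive (≡.cong (_× f (suc c)) (mult-∷-≢ xs (λ 1+k≡1+c → c≢k (ℕ.suc-injective (≡.sym 1+k≡1+c)))))
    newTerm : mult (suc k) (suc k ∷ xs) × f (suc k) ≈ mult (suc k) xs × f (suc k) ∙ f (suc k)
    newTerm = trans (reflexive (≡.cong (_× f (suc k)) (mult-∷-≡ (suc k) xs))) (comm _ _)

module CentralizerOrder where

  open ≡ using (refl; cong)
  open ≡.≡-Reasoning
  open import Data.Nat using (_+_; _*_; _^_; _!)
  open import Data.Nat.Solver using (module +-*-Solver)
  open +-*-Solver using (solve; _:+_; _:*_; _:=_; con)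
  open FiniteSum ℕ.*-1-commutativeMonoid using (∑-cong; ∑-bound-≡; ∑-extend; ∑-update; foldr-applyUpTo)
    renaming (∑ to ∏)
  open DescendingLists
  open Multiplicity

  factor : ℕ → List ℕ → ℕ
  factor i μ = i ^ mult i μ * mult i μ !

  zee-∏ : ∀ μ → zee μ ≡ ∏ (sum μ) (λ i → factor (suc i) μ)
  zee-∏ μ = ≡.trans (cong (foldr _ 1) (List.map-upTo suc (sum μ))) (foldr-applyUpTo (sum μ) (λ i → factor i μ) suc)

  zee-∏-extend : ∀ {μ N} → sum μ ≤ N → zee μ ≡ ∏ N (λ i → factor (suc i) μ)
  zee-∏-extend {μ} {N} sumμ≤N = ≡.trans (zee-∏ μ) (∑-extend (sum μ) N _ sumμ≤N trivialFactor)
    where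
    trivialFactor : ∀ i → sum μ ≤ i → i < N → factor (suc i) μ ≡ 1
    trivialFactor i sumμ≤i _ = cong (λ m → suc i ^ m * m !)
      (mult-∉ {xs = μ} (λ 1+i∈μ → ℕ.<-irrefl refl (ℕ.≤-trans (s≤s sumμ≤i) (∈⇒≤sum 1+i∈μ))))

  zee-↭ : ∀ {xs ys} → xs ↭ ys → zee xs ≡ zee ys
  zee-↭ {xs} {ys} xs↭ys = begin
    zee xs
      ≡⟨ zee-∏ xs ⟩
    ∏ (sum xs) (λ i → factor (suc i) xs)
      ≡⟨ ∑-bound-≡ _ (sum-↭ xs↭ys) ⟩
    ∏ (sum ys) (λ i → factor (suc i) xs)
      ≡⟨ ∑-cong (sum ys) (λ i → cong (λ m → suc i ^ m * m !) (mult-↭ (suc i) xs↭ys)) ⟩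
    ∏ (sum ys) (λ i → factor (suc i) ys)
      ≡⟨ zee-∏ ys ⟨
    zee ys ∎

  zee-∷ : ∀ {b} ν → 1 ≤ b → zee (b ∷ ν) ≡ zee ν * (b * mult b (b ∷ ν))
  zee-∷ {suc a} ν _ = begin
    zee (b ∷ ν)
      ≡⟨ zee-∏ (b ∷ ν) ⟩
    ∏ (b + sum ν) (λ i → factor (suc i) (b ∷ ν))
      ≡⟨ ∑-update (b + sum ν) a _ _ _ (ℕ.m≤m+n b (sum ν)) sameFactor newFactor ⟩
    ∏ (b + sum ν) (λ i → factor (suc i) ν) * (b * mult b (b ∷ ν))
      ≡⟨ cong (_* (b * mult b (b ∷ ν))) (zee-∏-extend {ν} (ℕ.m≤n+m (sum ν) b)) ⟨
    zee ν * (b * mult b (b ∷ ν)) ∎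
    where
    b = suc a
    sameFactor : ∀ i → i < b + sum ν → i ≢ a → factor (suc i) (b ∷ ν) ≡ factor (suc i) ν
    sameFactor i _ i≢a = cong (λ m → suc i ^ m * m !) (mult-∷-≢ ν (λ b≡1+i → i≢a (ℕ.suc-injective (≡.sym b≡1+i))))
    newFactor : factor b (b ∷ ν) ≡ factor b ν * (b * mult b (b ∷ ν))
    newFactor rewrite mult-∷-≡ b ν =
      solve 4 (λ B P F M → (B :* P) :* ((con 1 :+ M) :* F) := (P :* F) :* (B :* (con 1 :+ M)))
            refl b (b ^ mult b ν) (mult b ν !) (mult b ν)

  zee-remove : ∀ {b μ} → All (1 ≤_) μ → b ∈ μ → zee μ ≡ zee (remove b μ) * (b * mult b μ)
  zee-remove {b} {μ} μ>0 b∈μ = begin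
    zee μ                                    ≡⟨ zee-↭ (remove-↭ b∈μ) ⟩
    zee (b ∷ ν)                              ≡⟨ zee-∷ ν (All.lookup μ>0 b∈μ) ⟩
    zee ν * (b * mult b (b ∷ ν))             ≡⟨ cong (λ m → zee ν * (b * m)) (mult-↭ b (remove-↭ b∈μ)) ⟨
    zee ν * (b * mult b μ)                   ∎
    where ν = remove b μ

  zee-positive : ∀ μ → 1 ≤ zee μ
  zee-positive μ = ≡.subst (1 ≤_) (≡.sym (zee-∏ μ)) (∏-positive (sum μ))
    where
    ∏-positive : ∀ n → 1 ≤ ∏ n (λ i → factor (suc i) μ)
    ∏-positive zero    = ℕ.≤-refl
    ∏-positive (suc n) =
      ℕ.*-mono-≤ (∏-positive n) (ℕ.*-mono-≤ (ℕ.m^n>0 (suc n) (mult (suc n) μ)) (ℕ.1≤n! (mult (suc n) μ)))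

module PartitionLists where

  open ≡ using (refl; cong)
  open import Data.Nat using (_+_)
  open import Data.Product using (_×_)
  open DescendingLists

  ListsPartitions : ℕ → List (List ℕ) → Set
  ListsPartitions n L = Unique L × (∀ μ → μ ∈ L ⇔ IsPartition n μ)

  remove-IsPartition : ∀ {n b μ} → IsPartition n μ → b ∈ μ → IsPartition (n ∸ b) (remove b μ)
  remove-IsPartition {n} {b} {μ} (μ>0 , μ↘ , sumμ≡n) b∈μ = remove-All μ>0 , remove-↘ μ↘ , sum-remove
    where
    sum-remove : sum (remove b μ) ≡ n ∸ b
    sum-remove = ≡.trans (≡.sym (ℕ.m+n∸m≡n b _)) (cong (_∸ b) (≡.trans (≡.sym (sum-↭ (remove-↭ b∈μ))) sumμ≡n))

  sortDesc-IsPartition : ∀ {n b ν} → 1 ≤ b → b ≤ n → IsPartition (n ∸ b) ν → IsPartition n (sortDesc (b ∷ ν))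
  sortDesc-IsPartition {n} {b} {ν} b>0 b≤n (ν>0 , _ , sumν≡n∸b) =
    All-resp-↭ (↭-sym (sortDesc-↭ (b ∷ ν))) (b>0 ∷ ν>0) ,
    sortDesc-↘ (b ∷ ν) ,
    ≡.trans (sum-↭ (sortDesc-↭ (b ∷ ν))) (≡.trans (cong (b +_) sumν≡n∸b) (ℕ.m+[n∸m]≡n b≤n))

  withoutPart : ℕ → List (List ℕ) → List (List ℕ)
  withoutPart b L = map (remove b) (filter (b ∈?_) L)

  private
    Unique-map⁺ : ∀ {A B : Set} (f : A → B) {xs} → (∀ {x y} → x ∈ xs → y ∈ xs → f x ≡ f y → x ≡ y) →
                  Unique xs → Unique (map f xs)
    Unique-map⁺ f {[]}     _   []           = []
    Unique-map⁺ f {x ∷ xs} inj (x∉xs ∷ uxs) =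
      All.map⁺ (All.tabulate (λ y∈xs fx≡fy → All.lookup x∉xs y∈xs (inj (here refl) (there y∈xs) fx≡fy))) ∷
      Unique-map⁺ f (λ x∈ y∈ → inj (there x∈) (there y∈)) uxs
      where import Data.List.Relation.Unary.All.Properties as All

  withoutPart-ListsPartitions : ∀ {n b L} → 1 ≤ b → b ≤ n → ListsPartitions n L →
                                ListsPartitions (n ∸ b) (withoutPart b L)
  withoutPart-ListsPartitions {n} {b} {L} b>0 b≤n (uniqueL , L⇔) =
    Unique-map⁺ (remove b) removeInjective (Unique.filter⁺ (b ∈?_) uniqueL) , λ ν → mk⇔ (to ν) (from ν)
    where
    member : ∀ {μ} → μ ∈ filter (b ∈?_) L → IsPartition n μ × b ∈ μ
    member μ∈ with ∈.∈-filter⁻ (b ∈?_) {xs = L} μ∈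
    ... | μ∈L , b∈μ = Equivalence.to (L⇔ _) μ∈L , b∈μ
    removeInjective : ∀ {μ μ′} → μ ∈ filter (b ∈?_) L → μ′ ∈ filter (b ∈?_) L →
                      remove b μ ≡ remove b μ′ → μ ≡ μ′
    removeInjective μ∈ μ′∈ with member μ∈ | member μ′∈
    ... | (_ , μ↘ , _) , b∈μ | (_ , μ′↘ , _) , b∈μ′ = remove-injective μ↘ μ′↘ b∈μ b∈μ′
    to : ∀ ν → ν ∈ withoutPart b L → IsPartition (n ∸ b) ν
    to ν ν∈ with ∈.∈-map⁻ (remove b) ν∈
    ... | μ , μ∈ , refl = remove-IsPartition (proj₁ (member μ∈)) (proj₂ (member μ∈))
    from : ∀ ν → IsPartition (n ∸ b) ν → ν ∈ withoutPart b L
    from ν ν⊢n∸b@(_ , ν↘ , _) = ≡.subst (_∈ withoutPart b L) (remove-sortDesc ν↘)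
      (∈.∈-map⁺ (remove b) (∈.∈-filter⁺ (b ∈?_) (Equivalence.from (L⇔ _) (sortDesc-IsPartition b>0 b≤n ν⊢n∸b))
        (sortDesc-∋ b ν)))

  IsPartition-0 : ∀ {μ} → IsPartition 0 μ → μ ≡ []
  IsPartition-0 {[]}     _                        = refl
  IsPartition-0 {x ∷ xs} (x>0 ∷ _ , _ , sumμ≡0) =
    ⊥-elim (ℕ.<-irrefl refl (ℕ.≤-trans x>0 (ℕ.≤-trans (ℕ.m≤m+n x (sum xs)) (ℕ.≤-reflexive sumμ≡0))))

  ListsPartitions-0 : ∀ {E} → ListsPartitions 0 E → E ≡ [] ∷ []
  ListsPartitions-0 {[]}         (_ , E⇔) with Equivalence.from (E⇔ []) ([] , Linked.[] , refl)
  ... | ()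
  ListsPartitions-0 {μ ∷ []}     (_ , E⇔) = cong (_∷ []) (IsPartition-0 (Equivalence.to (E⇔ μ) (here refl)))
  ListsPartitions-0 {μ ∷ μ′ ∷ _} ((μ∉ ∷ _) , E⇔) = ⊥-elim (All.lookup μ∉ (here refl)
    (≡.trans (IsPartition-0 (Equivalence.to (E⇔ μ) (here refl)))
             (≡.sym (IsPartition-0 (Equivalence.to (E⇔ μ′) (there (here refl)))))))

module MarkedPart where

  open ≡ using (cong)
  open import Data.Nat using (_*_)
  open PolyRing
  open PolyConstants
  open RingSum commutativeRing
  open DescendingLists
  open Multiplicity
  open CentralizerOrder
  open PartitionLists
  open MultiplicitySum R.+-commutativeMonoid
  open import Algebra.Solver.Ring.NaturalCoefficients.Default R.commutativeSemiring
  open import Relation.Binary.Reasoning.Setoid R.setoid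

  weight : List ℕ → Poly
  weight ν = recip (zee ν) · (Xv ^P length ν)

  weightSum : List (List ℕ) → Poly
  weightSum E = sumP (map weight E)

  -- lhsTerm is markedTerm (λ p → Yv ^P p ⊖ 1P); the recurrence for weightSum uses f = natP.
  markedTerm : (ℕ → Poly) → List ℕ → Poly
  markedTerm f μ = recip (zee μ) · ((Xv ^P (length μ ∸ 1)) ⊛ sumP (map f μ))

  markedWeight : ℕ → List ℕ → Poly
  markedWeight b μ = natP (mult b μ) ⊛ (recipP (zee μ) ⊛ (Xv ^P (length μ ∸ 1)))

  markedWeight-remove : ∀ {b μ} → All (1 ≤_) μ → b ∈ μ → markedWeight b μ ≐ (recipP b ⊛ weight (remove b μ))
  markedWeight-remove {b} {μ} μ>0 b∈μ = begin
    natP m ⊛ (recipP (zee μ) ⊛ (Xv ^P (length μ ∸ 1)))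
      ≈⟨ ⊛-congˡ (natP m) (R.*-cong (cst-cong (cong recip (zee-remove μ>0 b∈μ)))
                                    (R.reflexive (cong (λ l → Xv ^P (l ∸ 1)) (↭-length (remove-↭ b∈μ))))) ⟩
    natP m ⊛ (recipP (zee ν * (b * m)) ⊛ (Xv ^P length ν))
      ≈⟨ solve 3 (λ M Z X → M :* (Z :* X) := (Z :* M) :* X) R.refl
               (natP m) (recipP (zee ν * (b * m))) (Xv ^P length ν) ⟩
    (recipP (zee ν * (b * m)) ⊛ natP m) ⊛ (Xv ^P length ν)
      ≈⟨ ⊛-congʳ (Xv ^P length ν) (recipP-*-cancel-natP (zee ν) b m (zee-positive ν) (All.lookup μ>0 b∈μ) m>0) ⟩
    (recipP (zee ν) ⊛ recipP b) ⊛ (Xv ^P length ν)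
      ≈⟨ solve 3 (λ Z B X → (Z :* B) :* X := B :* (Z :* X)) R.refl (recipP (zee ν)) (recipP b) (Xv ^P length ν) ⟩
    recipP b ⊛ (recipP (zee ν) ⊛ (Xv ^P length ν))
      ≈⟨ ⊛-congˡ (recipP b) (·-≐-cst-⊛ (recip (zee ν)) (Xv ^P length ν)) ⟨
    recipP b ⊛ weight ν ∎
    where
    ν = remove b μ
    m = mult b μ
    m>0 : 1 ≤ m
    m>0 = ≡.subst (1 ≤_) (≡.trans (≡.sym (mult-∷-≡ b ν)) (mult-↭ b (↭-sym (remove-↭ b∈μ)))) (s≤s z≤n)

  markedWeight-∉ : ∀ {b μ} → b ∉ μ → markedWeight b μ ≐ 0P
  markedWeight-∉ {b} {μ} b∉μ =
    R.trans (⊛-congʳ rest (R.trans (cst-cong (cong ℕtoℚ (mult-∉ {xs = μ} b∉μ))) natP-0)) (R.zeroˡ rest)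
    where rest = recipP (zee μ) ⊛ (Xv ^P (length μ ∸ 1))

  markedTerm-expand : ∀ {n μ} f → IsPartition n μ →
                      markedTerm f μ ≐ (∑[ c < n ] (f (suc c) ⊛ markedWeight (suc c) μ))
  markedTerm-expand {n} {μ} f (μ>0 , _ , sumμ≡n) = begin
    recip (zee μ) · (X ⊛ sumP (map f μ))
      ≈⟨ ·-≐-cst-⊛ (recip (zee μ)) _ ⟩
    r ⊛ (X ⊛ sumP (map f μ))
      ≈⟨ ⊛-congˡ r (⊛-congˡ X (R.trans (sumₗ-map-mult n f μ>0 μ≤n)
                                        (∑-cong n (λ c → ×-≐-natP-⊛ (mult (suc c) μ) (f (suc c)))))) ⟩
    r ⊛ (X ⊛ ∑[ c < n ] (natP (mult (suc c) μ) ⊛ f (suc c)))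
      ≈⟨ R.trans (⊛-congˡ r (*-distribˡ-∑ n X _)) (*-distribˡ-∑ n r _) ⟩
    ∑[ c < n ] (r ⊛ (X ⊛ (natP (mult (suc c) μ) ⊛ f (suc c))))
      ≈⟨ ∑-cong n (λ c → solve 4 (λ R X M F → R :* (X :* (M :* F)) := F :* (M :* (R :* X))) R.refl
                                 r X (natP (mult (suc c) μ)) (f (suc c))) ⟩
    ∑[ c < n ] (f (suc c) ⊛ markedWeight (suc c) μ) ∎
    where
    r = recipP (zee μ)
    X = Xv ^P (length μ ∸ 1)
    μ≤n : All (_≤ n) μ
    μ≤n = All.tabulate (λ p∈μ → ≡.subst (_ ≤_) sumμ≡n (∈⇒≤sum p∈μ))

  sumP-markedWeight : ∀ {n L} → ListsPartitions n L → ∀ b F →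
                      sumP (map (λ μ → F ⊛ markedWeight b μ) L) ≐ (F ⊛ (recipP b ⊛ weightSum (withoutPart b L)))
  sumP-markedWeight {n} {L} (_ , L⇔) b F = begin
    sumP (map (λ μ → F ⊛ markedWeight b μ) L)
      ≈⟨ sumₗ-map-filter (b ∈?_) L _ (λ μ _ b∉μ → R.trans (⊛-congˡ F (markedWeight-∉ b∉μ)) (R.zeroʳ F)) ⟩
    sumP (map (λ μ → F ⊛ markedWeight b μ) (filter (b ∈?_) L))
      ≈⟨ sumₗ-map-cong (filter (b ∈?_) L) (λ μ μ∈ →
           ⊛-congˡ F (markedWeight-remove (partsPositive μ∈) (hasPart μ∈))) ⟩
    sumP (map (λ μ → F ⊛ (recipP b ⊛ weight (remove b μ))) (filter (b ∈?_) L))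
      ≈⟨ R.reflexive (cong sumP (List.map-∘ (filter (b ∈?_) L))) ⟩
    sumP (map (λ ν → F ⊛ (recipP b ⊛ weight ν)) (withoutPart b L))
      ≈⟨ R.trans (⊛-congˡ F (*-distribˡ-sumₗ (withoutPart b L) (recipP b) weight))
                 (*-distribˡ-sumₗ (withoutPart b L) F (λ ν → recipP b ⊛ weight ν)) ⟨
    F ⊛ (recipP b ⊛ weightSum (withoutPart b L)) ∎
    where
    partsPositive : ∀ {μ} → μ ∈ filter (b ∈?_) L → All (1 ≤_) μ
    partsPositive μ∈ = proj₁ (Equivalence.to (L⇔ _) (proj₁ (∈.∈-filter⁻ (b ∈?_) {xs = L} μ∈)))
    hasPart : ∀ {μ} → μ ∈ filter (b ∈?_) L → b ∈ μ
    hasPart μ∈ = proj₂ (∈.∈-filter⁻ (b ∈?_) {xs = L} μ∈)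

  markedSum-decompose : ∀ {n L} → ListsPartitions n L → ∀ f →
    sumP (map (markedTerm f) L) ≐ (∑[ c < n ] (f (suc c) ⊛ (recipP (suc c) ⊛ weightSum (withoutPart (suc c) L))))
  markedSum-decompose {n} {L} L⊢n@(_ , L⇔) f = begin
    sumP (map (markedTerm f) L)
      ≈⟨ sumₗ-map-cong L (λ μ μ∈L → markedTerm-expand f (Equivalence.to (L⇔ μ) μ∈L)) ⟩
    sumP (map (λ μ → ∑[ c < n ] (f (suc c) ⊛ markedWeight (suc c) μ)) L)
      ≈⟨ sumₗ-map-∑ L n (λ μ c → f (suc c) ⊛ markedWeight (suc c) μ) ⟩
    ∑[ c < n ] sumP (map (λ μ → f (suc c) ⊛ markedWeight (suc c) μ) L)
      ≈⟨ ∑-cong n (λ c → sumP-markedWeight L⊢n (suc c) (f (suc c))) ⟩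
    ∑[ c < n ] (f (suc c) ⊛ (recipP (suc c) ⊛ weightSum (withoutPart (suc c) L))) ∎

module FallingFactorials where

  open ≡ using (refl; cong)
  open import Data.Nat using (_*_; _!)
  open PolyRing
  open PolyConstants
  open RingSum commutativeRing
  module Π = FiniteSum R.*-commutativeMonoid
  open import Algebra.Solver.Ring.NaturalCoefficients.Default R.commutativeSemiring
  open import Relation.Binary.Reasoning.Setoid R.setoid

  fallingX : ℕ → ℕ → Poly
  fallingX n s = Π.∑ s (λ j → Xv ⊕ natP (n ∸ suc j))

  binomX-fallingX : ∀ n s → binomX n s ≐ (recipP (s !) ⊛ fallingX n s)
  binomX-fallingX n s = R.trans (·-≐-cst-⊛ (recip (s !)) _) (⊛-congˡ (recipP (s !))
    (R.trans (R.reflexive (List.foldr-map _⊛_ _ 1P (upTo s))) (Π.foldr-applyUpTo s _ (λ j → j))))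

  recipP-! : ∀ s → recipP (s !) ≐ (recipP (suc s !) ⊛ natP (suc s))
  recipP-! s with s ! | ℕ.1≤n! s
  ... | suc t | _ = R.sym (begin
    recipP (suc s * suc t) ⊛ natP (suc s)              ≈⟨ ⊛-congʳ (natP (suc s)) (recipP-homo-* s t) ⟩
    (recipP (suc s) ⊛ recipP (suc t)) ⊛ natP (suc s)   ≈⟨ solve 3 (λ A B C → (A :* B) :* C := B :* (A :* C)) R.refl
                                                                (recipP (suc s)) (recipP (suc t)) (natP (suc s)) ⟩
    recipP (suc t) ⊛ (recipP (suc s) ⊛ natP (suc s))   ≈⟨ ⊛-congˡ (recipP (suc t)) (recipP-inverseˡ s) ⟩
    recipP (suc t) ⊛ 1P                                ≈⟨ R.*-identityʳ _ ⟩
    recipP (suc t)                                     ∎)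

  binomX-pascal : ∀ n s → suc s ≤ n → binomX (suc n) (suc s) ≐ (binomX n (suc s) ⊕ binomX n s)
  binomX-pascal n s s<n = begin
    binomX (suc n) (suc s)
      ≈⟨ binomX-fallingX (suc n) (suc s) ⟩
    r ⊛ fallingX (suc n) (suc s)
      ≈⟨ ⊛-congˡ r (Π.∑-unfoldˡ s (λ j → Xv ⊕ natP (suc n ∸ suc j))) ⟩
    r ⊛ ((Xv ⊕ natP n) ⊛ Q)
      ≈⟨ ⊛-congˡ r (⊛-congʳ Q (⊕-congˡ Xv (R.trans (R.reflexive (cong natP (≡.sym (ℕ.m∸n+n≡m s<n))))
                                                    (natP-homo-+ (n ∸ suc s) (suc s))))) ⟩
    r ⊛ ((Xv ⊕ (a ⊕ c)) ⊛ Q)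
      ≈⟨ solve 5 (λ r X a c Q → r :* ((X :+ (a :+ c)) :* Q) := r :* (Q :* (X :+ a)) :+ (r :* c) :* Q)
               R.refl r Xv a c Q ⟩
    (r ⊛ (Q ⊛ (Xv ⊕ a))) ⊕ ((r ⊛ c) ⊛ Q)
      ≈⟨ R.+-cong (R.sym (binomX-fallingX n (suc s)))
                  (R.sym (R.trans (binomX-fallingX n s) (⊛-congʳ Q (recipP-! s)))) ⟩
    binomX n (suc s) ⊕ binomX n s ∎
    where
    r = recipP (suc s !)
    Q = fallingX n s
    a = natP (n ∸ suc s)
    c = natP (suc s)

  multichoose : ℕ → Poly
  multichoose m = binomX m m

  -- binom(X+n−1, n−k), extended by 0 for k > n so that Pascal's rule holds for all n and k.
  binomXCompl : ℕ → ℕ → Poly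
  binomXCompl n k with k ≤? n
  ... | yes _ = binomX n (n ∸ k)
  ... | no  _ = 0P

  binomXCompl-≤ : ∀ n k → k ≤ n → binomXCompl n k ≐ binomX n (n ∸ k)
  binomXCompl-≤ n k k≤n with k ≤? n
  ... | yes _  = R.refl
  ... | no k≰n = ⊥-elim (k≰n k≤n)

  binomXCompl-> : ∀ n k → n < k → binomXCompl n k ≐ 0P
  binomXCompl-> n k n<k with k ≤? n
  ... | yes k≤n = ⊥-elim (ℕ.<⇒≱ n<k k≤n)
  ... | no  _   = R.refl

  binomXCompl-pascal : ∀ n k → binomXCompl (suc n) (suc k) ≐ (binomXCompl n k ⊕ binomXCompl n (suc k))
  binomXCompl-pascal n k with ℕ.<-cmp k n
  ... | tri< k<n _ _ = begin
    binomXCompl (suc n) (suc k)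
      ≈⟨ binomXCompl-≤ (suc n) (suc k) (s≤s (ℕ.<⇒≤ k<n)) ⟩
    binomX (suc n) (n ∸ k)
      ≈⟨ R.reflexive (cong (binomX (suc n)) n∸k≡1+n∸1+k) ⟩
    binomX (suc n) (suc (n ∸ suc k))
      ≈⟨ binomX-pascal n (n ∸ suc k) (≡.subst (_≤ n) n∸k≡1+n∸1+k (ℕ.m∸n≤m n k)) ⟩
    binomX n (suc (n ∸ suc k)) ⊕ binomX n (n ∸ suc k)
      ≈⟨ ⊕-congʳ (binomX n (n ∸ suc k)) (R.reflexive (cong (binomX n) n∸k≡1+n∸1+k)) ⟨
    binomX n (n ∸ k) ⊕ binomX n (n ∸ suc k)
      ≈⟨ R.+-cong (binomXCompl-≤ n k (ℕ.<⇒≤ k<n)) (binomXCompl-≤ n (suc k) k<n) ⟨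
    binomXCompl n k ⊕ binomXCompl n (suc k) ∎
    where
    n∸k≡1+n∸1+k : n ∸ k ≡ suc (n ∸ suc k)
    n∸k≡1+n∸1+k = ℕ.+-∸-assoc 1 k<n
  ... | tri≈ _ refl _ = begin
    binomXCompl (suc k) (suc k)                    ≈⟨ binomXCompl-≤ (suc k) (suc k) ℕ.≤-refl ⟩
    binomX (suc k) (k ∸ k)                         ≈⟨ R.reflexive (cong (binomX (suc k)) (ℕ.n∸n≡0 k)) ⟩
    binomX k 0                                     ≈⟨ R.reflexive (cong (binomX k) (ℕ.n∸n≡0 k)) ⟨
    binomX k (k ∸ k)                               ≈⟨ R.+-identityʳ _ ⟨
    binomX k (k ∸ k) ⊕ 0P                          ≈⟨ R.+-cong (binomXCompl-≤ k k ℕ.≤-refl)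
                                                                (binomXCompl-> k (suc k) ℕ.≤-refl) ⟨
    binomXCompl k k ⊕ binomXCompl k (suc k)        ∎
  ... | tri> _ _ n<k = begin
    binomXCompl (suc n) (suc k)                    ≈⟨ binomXCompl-> (suc n) (suc k) (s≤s n<k) ⟩
    0P                                             ≈⟨ R.+-identityʳ 0P ⟨
    0P ⊕ 0P                                        ≈⟨ R.+-cong (binomXCompl-> n k n<k)
                                                                (binomXCompl-> n (suc k) (ℕ.m<n⇒m<1+n n<k)) ⟨
    binomXCompl n k ⊕ binomXCompl n (suc k)        ∎

  chu-vandermonde : ∀ n j → (∑[ c < n ] (natP (c C j) ⊛ multichoose (n ∸ suc c))) ≐ binomXCompl n (suc j)
  chu-vandermonde zero    j = R.sym (binomXCompl-> 0 (suc j) (s≤s z≤n))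
  chu-vandermonde (suc n) zero = begin
    ∑[ c < suc n ] (natP 1 ⊛ multichoose (suc n ∸ suc c))
      ≈⟨ ∑-unfoldˡ n _ ⟩
    (natP 1 ⊛ multichoose n) ⊕ ∑[ c < n ] (natP 1 ⊛ multichoose (n ∸ suc c))
      ≈⟨ R.+-cong (R.*-identityˡ (multichoose n)) (chu-vandermonde n 0) ⟩
    multichoose n ⊕ binomXCompl n 1
      ≈⟨ ⊕-congʳ (binomXCompl n 1) (binomXCompl-≤ n 0 z≤n) ⟨
    binomXCompl n 0 ⊕ binomXCompl n 1
      ≈⟨ binomXCompl-pascal n 0 ⟨
    binomXCompl (suc n) 1 ∎
  chu-vandermonde (suc n) (suc j) = begin
    ∑[ c < suc n ] (natP (c C suc j) ⊛ multichoose (suc n ∸ suc c))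
      ≈⟨ ∑-unfoldˡ n _ ⟩
    (natP 0 ⊛ multichoose n) ⊕ ∑[ c < n ] (natP (suc c C suc j) ⊛ multichoose (n ∸ suc c))
      ≈⟨ R.+-cong (R.trans (⊛-congʳ (multichoose n) natP-0) (R.zeroˡ (multichoose n))) (∑-cong n pascalTerm) ⟩
    0P ⊕ ∑[ c < n ] ((natP (c C j) ⊛ B c) ⊕ (natP (c C suc j) ⊛ B c))
      ≈⟨ R.trans (R.+-identityˡ _) (∑-distrib-∙ n _ _) ⟩
    ∑[ c < n ] (natP (c C j) ⊛ B c) ⊕ ∑[ c < n ] (natP (c C suc j) ⊛ B c)
      ≈⟨ R.+-cong (chu-vandermonde n j) (chu-vandermonde n (suc j)) ⟩
    binomXCompl n (suc j) ⊕ binomXCompl n (suc (suc j))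
      ≈⟨ binomXCompl-pascal n (suc j) ⟨
    binomXCompl (suc n) (suc (suc j)) ∎
    where
    B : ℕ → Poly
    B c = multichoose (n ∸ suc c)
    pascalTerm : ∀ c → (natP (suc c C suc j) ⊛ B c) ≐ ((natP (c C j) ⊛ B c) ⊕ (natP (c C suc j) ⊛ B c))
    pascalTerm c = R.trans (⊛-congʳ (B c) (R.trans (R.reflexive (cong natP (≡.sym (nCk+nC[k+1]≡[n+1]C[k+1] c j))))
                                                   (natP-homo-+ (c C j) (c C suc j))))
                           (R.distribʳ (B c) (natP (c C j)) (natP (c C suc j)))

  multichoose-recurrence : ∀ m → (natP (suc m) ⊛ multichoose (suc m)) ≐ (Xv ⊛ ∑[ c < suc m ] multichoose (m ∸ c))
  multichoose-recurrence m = begin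
    natP (suc m) ⊛ multichoose (suc m)
      ≈⟨ ⊛-congˡ (natP (suc m)) (binomX-fallingX (suc m) (suc m)) ⟩
    natP (suc m) ⊛ (r ⊛ (F ⊛ (Xv ⊕ natP (m ∸ m))))
      ≈⟨ ⊛-congˡ (natP (suc m)) (⊛-congˡ r (⊛-congˡ F
           (R.trans (⊕-congˡ Xv (R.trans (R.reflexive (cong natP (ℕ.n∸n≡0 m))) natP-0)) (R.+-identityʳ Xv)))) ⟩
    natP (suc m) ⊛ (r ⊛ (F ⊛ Xv))
      ≈⟨ solve 4 (λ N r F X → N :* (r :* (F :* X)) := X :* ((r :* N) :* F)) R.refl (natP (suc m)) r F Xv ⟩
    Xv ⊛ ((r ⊛ natP (suc m)) ⊛ F)
      ≈⟨ ⊛-congˡ Xv (R.trans (⊛-congʳ F (R.sym (recipP-! m))) (R.sym (binomX-fallingX (suc m) m))) ⟩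
    Xv ⊛ binomX (suc m) m
      ≈⟨ ⊛-congˡ Xv (R.trans (chu-vandermonde (suc m) 0) (binomXCompl-≤ (suc m) 1 (s≤s z≤n))) ⟨
    Xv ⊛ ∑[ c < suc m ] (natP 1 ⊛ multichoose (m ∸ c))
      ≈⟨ ⊛-congˡ Xv (∑-cong (suc m) (λ c → R.*-identityˡ (multichoose (m ∸ c)))) ⟩
    Xv ⊛ ∑[ c < suc m ] multichoose (m ∸ c) ∎
    where
    r = recipP (suc m !)
    F = fallingX (suc m) m

module CycleIndex where

  open ≡ using (cong)

  open PolyRing
  open PolyConstants
  open RingSum commutativeRing
  open PartitionLists
  open MarkedPart
  open FallingFactorials
  open import Algebra.Solver.Ring.NaturalCoefficients.Default R.commutativeSemiring
  open import Relation.Binary.Reasoning.Setoid R.setoid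

  sumP-map-natP : ∀ μ → sumP (map natP μ) ≐ natP (sum μ)
  sumP-map-natP []       = R.sym natP-0
  sumP-map-natP (x ∷ xs) = R.trans (⊕-congˡ (natP x) (sumP-map-natP xs)) (R.sym (natP-homo-+ x (sum xs)))

  Xv-markedTerm-natP : ∀ {n μ} → IsPartition (suc n) μ → (Xv ⊛ markedTerm natP μ) ≐ (natP (suc n) ⊛ weight μ)
  Xv-markedTerm-natP {n} {x ∷ xs} (_ , _ , sumμ≡1+n) = begin
    Xv ⊛ (recip z · (X ⊛ sumP (map natP (x ∷ xs))))
      ≈⟨ ⊛-congˡ Xv (R.trans (·-≐-cst-⊛ (recip z) _) (⊛-congˡ (recipP z) (⊛-congˡ X
           (R.trans (sumP-map-natP (x ∷ xs)) (cst-cong (cong ℕtoℚ sumμ≡1+n)))))) ⟩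
    Xv ⊛ (recipP z ⊛ (X ⊛ natP (suc n)))
      ≈⟨ solve 4 (λ Y R X N → Y :* (R :* (X :* N)) := N :* (R :* (Y :* X))) R.refl Xv (recipP z) X (natP (suc n)) ⟩
    natP (suc n) ⊛ (recipP z ⊛ (Xv ⊛ X))
      ≈⟨ ⊛-congˡ (natP (suc n)) (·-≐-cst-⊛ (recip z) (Xv ⊛ X)) ⟨
    natP (suc n) ⊛ weight (x ∷ xs) ∎
    where
    z = zee (x ∷ xs)
    X = Xv ^P length xs

  weightSum-recurrence : ∀ {m E} → ListsPartitions (suc m) E →
    (natP (suc m) ⊛ weightSum E) ≐ (Xv ⊛ ∑[ c < suc m ] weightSum (withoutPart (suc c) E))
  weightSum-recurrence {m} {E} E⊢1+m@(_ , E⇔) = begin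
    natP (suc m) ⊛ weightSum E
      ≈⟨ *-distribˡ-sumₗ E (natP (suc m)) weight ⟩
    sumP (map (λ μ → natP (suc m) ⊛ weight μ) E)
      ≈⟨ sumₗ-map-cong E (λ μ μ∈E → Xv-markedTerm-natP (Equivalence.to (E⇔ μ) μ∈E)) ⟨
    sumP (map (λ μ → Xv ⊛ markedTerm natP μ) E)
      ≈⟨ *-distribˡ-sumₗ E Xv (markedTerm natP) ⟨
    Xv ⊛ sumP (map (markedTerm natP) E)
      ≈⟨ ⊛-congˡ Xv (markedSum-decompose E⊢1+m natP) ⟩
    Xv ⊛ ∑[ c < suc m ] (natP (suc c) ⊛ (recipP (suc c) ⊛ weightSum (withoutPart (suc c) E)))
      ≈⟨ ⊛-congˡ Xv (∑-cong (suc m) (λ c → natP-recipP-cancelˡ c (weightSum (withoutPart (suc c) E)))) ⟩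
    Xv ⊛ ∑[ c < suc m ] weightSum (withoutPart (suc c) E) ∎

  weightSum-multichoose : ∀ m {E} → ListsPartitions m E → weightSum E ≐ multichoose m
  weightSum-multichoose = <-rec _ go
    where
    go : ∀ m → (∀ {k} → k < m → ∀ {E} → ListsPartitions k E → weightSum E ≐ multichoose k) →
         ∀ {E} → ListsPartitions m E → weightSum E ≐ multichoose m
    -- weight [] and multichoose 0 are both recip 1 · 1P by definition.
    go zero    _  E⊢0 rewrite ListsPartitions-0 E⊢0 = R.+-identityʳ (multichoose 0)
    go (suc m) ih {E} E⊢1+m = begin
      weightSum E
        ≈⟨ recipP-cancelˡ m (weightSum E) ⟨
      recipP (suc m) ⊛ (natP (suc m) ⊛ weightSum E)
        ≈⟨ ⊛-congˡ (recipP (suc m)) (weightSum-recurrence E⊢1+m) ⟩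
      recipP (suc m) ⊛ (Xv ⊛ ∑[ c < suc m ] weightSum (withoutPart (suc c) E))
        ≈⟨ ⊛-congˡ (recipP (suc m)) (⊛-congˡ Xv (∑-cong-< (suc m) (λ c c≤m →
             ih (s≤s (ℕ.m∸n≤m m c)) (withoutPart-ListsPartitions (s≤s z≤n) c≤m E⊢1+m)))) ⟩
      recipP (suc m) ⊛ (Xv ⊛ ∑[ c < suc m ] multichoose (m ∸ c))
        ≈⟨ ⊛-congˡ (recipP (suc m)) (multichoose-recurrence m) ⟨
      recipP (suc m) ⊛ (natP (suc m) ⊛ multichoose (suc m))
        ≈⟨ recipP-cancelˡ m (multichoose (suc m)) ⟩
      multichoose (suc m) ∎

module BinomialCoefficients where

  open ≡ using (refl; cong; cong₂)
  open ≡.≡-Reasoning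
  open import Data.Nat using (_+_; _*_)
  open import Data.Nat.Solver using (module +-*-Solver)
  open +-*-Solver using (solve; _:+_; _:*_; _:=_; con)

  suc-*-C-suc : ∀ c k → suc k * (suc c C suc k) ≡ suc c * (c C k)
  suc-*-C-suc c       zero     = ≡.trans (ℕ.+-identityʳ _) (≡.trans (nC1≡n (suc c)) (≡.sym (ℕ.*-identityʳ (suc c))))
  suc-*-C-suc zero    (suc k)  = ℕ.*-zeroʳ (suc (suc k))
  suc-*-C-suc (suc c) (suc k) = begin
    suc (suc k) * (suc (suc c) C suc (suc k))
      ≡⟨ cong (suc (suc k) *_) (nCk+nC[k+1]≡[n+1]C[k+1] (suc c) (suc k)) ⟨
    suc (suc k) * (A + B)
      ≡⟨ solve 3 (λ K A B → (con 1 :+ K) :* (A :+ B) := A :+ K :* A :+ (con 1 :+ K) :* B) refl (suc k) A B ⟩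
    A + suc k * A + suc (suc k) * B
      ≡⟨ cong₂ (λ u v → A + u + v) (suc-*-C-suc c k) (suc-*-C-suc c (suc k)) ⟩
    A + suc c * (c C k) + suc c * (c C suc k)
      ≡⟨ solve 4 (λ A C P Q → A :+ C :* P :+ C :* Q := A :+ C :* (P :+ Q)) refl A (suc c) (c C k) (c C suc k) ⟩
    A + suc c * (c C k + c C suc k)
      ≡⟨ cong (λ m → A + suc c * m) (nCk+nC[k+1]≡[n+1]C[k+1] c k) ⟩
    suc (suc c) * A ∎
    where
    A = suc c C suc k
    B = suc c C suc (suc k)

module RightHandSide where

  open ≡ using (cong)
  open PolyRing
  open PolyConstants
  open RingSum commutativeRing
  open FallingFactorials
  open BinomialCoefficients
  open import Algebra.Definitions.RawMonoid R.+-rawMonoid using (_×_)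
  open import Algebra.Properties.Monoid.Mult R.+-monoid using (×-congʳ)
  open import Algebra.Properties.Semiring.Exp R.semiring using (_^_; ^-congˡ)
  open import Algebra.Properties.AbelianGroup R.+-abelianGroup using (xyx⁻¹≈y)
  open import Algebra.Solver.Ring.NaturalCoefficients.Default R.commutativeSemiring
  open import Relation.Binary.Reasoning.Setoid R.setoid

  Yv-1 : Poly
  Yv-1 = Yv ⊖ 1P

  Yv≐Yv-1⊕1P : Yv ≐ (Yv-1 ⊕ 1P)
  Yv≐Yv-1⊕1P = R.sym (R.trans (R.+-assoc Yv (⊝ 1P) 1P) (R.trans (⊕-congˡ Yv (R.-‿inverseˡ 1P)) (R.+-identityʳ Yv)))

  ^P-≐-^ : ∀ p k → (p ^P k) ≐ (p ^ k)
  ^P-≐-^ p zero    = R.refl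
  ^P-≐-^ p (suc k) = ⊛-congˡ p (^P-≐-^ p k)

  Yv^[1+c]-1 : ∀ c → ((Yv ^P suc c) ⊖ 1P) ≐ (∑[ k < suc c ] (natP (suc c C suc k) ⊛ (Yv-1 ^P suc k)))
  Yv^[1+c]-1 c = begin
    (Yv ^P suc c) ⊖ 1P
      ≈⟨ ⊕-congʳ (⊝ 1P) (R.trans (^P-≐-^ Yv (suc c)) (R.trans (^-congˡ (suc c) Yv≐Yv-1⊕1P)
                          (R.trans (binomial-+1 Yv-1 (suc c)) (∑-unfoldˡ (suc c) _)))) ⟩
    ((1P ⊕ 0P) ⊕ S) ⊖ 1P
      ≈⟨ ⊕-congʳ (⊝ 1P) (⊕-congʳ S (R.+-identityʳ 1P)) ⟩
    (1P ⊕ S) ⊖ 1P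
      ≈⟨ xyx⁻¹≈y 1P S ⟩
    S
      ≈⟨ ∑-cong (suc c) (λ k → R.trans (×-congʳ (suc c C suc k) (R.sym (^P-≐-^ Yv-1 (suc k))))
                                       (×-≐-natP-⊛ (suc c C suc k) (Yv-1 ^P suc k))) ⟩
    ∑[ k < suc c ] (natP (suc c C suc k) ⊛ (Yv-1 ^P suc k)) ∎
    where
    S = ∑[ k < suc c ] ((suc c C suc k) × (Yv-1 ^ suc k))

  rhsTerm-expand : ∀ n c → c < n →
    (((Yv ^P suc c) ⊖ 1P) ⊛ (recipP (suc c) ⊛ multichoose (n ∸ suc c)))
      ≐ (∑[ k < n ] ((recipP (suc k) ⊛ (Yv-1 ^P suc k)) ⊛ (natP (c C k) ⊛ multichoose (n ∸ suc c))))
  rhsTerm-expand n c c<n = begin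
    ((Yv ^P suc c) ⊖ 1P) ⊛ (rc ⊛ B)
      ≈⟨ R.trans (⊛-congʳ (rc ⊛ B) (Yv^[1+c]-1 c)) (*-distribʳ-∑ (suc c) (rc ⊛ B) _) ⟩
    ∑[ k < suc c ] ((natP (suc c C suc k) ⊛ (Yv-1 ^P suc k)) ⊛ (rc ⊛ B))
      ≈⟨ ∑-cong (suc c) (λ k → solve 4 (λ N V R B → (N :* V) :* (R :* B) := (R :* N) :* (V :* B)) R.refl
                                       (natP (suc c C suc k)) (Yv-1 ^P suc k) rc B) ⟩
    ∑[ k < suc c ] ((rc ⊛ natP (suc c C suc k)) ⊛ ((Yv-1 ^P suc k) ⊛ B))
      ≈⟨ ∑-cong (suc c) (λ k → ⊛-congʳ ((Yv-1 ^P suc k) ⊛ B)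
                                 (recipP-natP-cross k c (suc c C suc k) (c C k) (suc-*-C-suc c k))) ⟩
    ∑[ k < suc c ] ((recipP (suc k) ⊛ natP (c C k)) ⊛ ((Yv-1 ^P suc k) ⊛ B))
      ≈⟨ ∑-cong (suc c) (λ k → solve 4 (λ R N V B → (R :* N) :* (V :* B) := (R :* V) :* (N :* B)) R.refl
                                       (recipP (suc k)) (natP (c C k)) (Yv-1 ^P suc k) B) ⟩
    ∑[ k < suc c ] ((recipP (suc k) ⊛ (Yv-1 ^P suc k)) ⊛ (natP (c C k) ⊛ B))
      ≈⟨ ∑-extend (suc c) n _ c<n vanishing ⟩
    ∑[ k < n ] ((recipP (suc k) ⊛ (Yv-1 ^P suc k)) ⊛ (natP (c C k) ⊛ B)) ∎
    where
    rc = recipP (suc c)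
    B = multichoose (n ∸ suc c)
    vanishing : ∀ k → suc c ≤ k → k < n → ((recipP (suc k) ⊛ (Yv-1 ^P suc k)) ⊛ (natP (c C k) ⊛ B)) ≐ 0P
    vanishing k c<k _ = R.trans (⊛-congˡ (recipP (suc k) ⊛ (Yv-1 ^P suc k))
      (R.trans (⊛-congʳ B (R.trans (cst-cong (cong ℕtoℚ (k>n⇒nCk≡0 c<k))) natP-0)) (R.zeroˡ B)))
      (R.zeroʳ (recipP (suc k) ⊛ (Yv-1 ^P suc k)))

  rhsCoeff≐∑ : ∀ n → rhsCoeff n ≐ (∑[ k < n ] (recip (suc k) · (binomX n (n ∸ suc k) ⊛ (Yv-1 ^P suc k))))
  rhsCoeff≐∑ n = R.trans
    (R.reflexive (≡.trans (cong (λ ks → sumP (map g ks)) (List.map-upTo suc n)) (List.foldr-map _⊕_ g 0P (applyUpTo suc n))))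
    (foldr-applyUpTo n g suc)
    where
    g : ℕ → Poly
    g k = recip k · (binomX n (n ∸ k) ⊛ (Yv-1 ^P k))

  multichooseSum≐rhsCoeff : ∀ n →
    (∑[ c < n ] (((Yv ^P suc c) ⊖ 1P) ⊛ (recipP (suc c) ⊛ multichoose (n ∸ suc c)))) ≐ rhsCoeff n
  multichooseSum≐rhsCoeff n = begin
    ∑[ c < n ] (((Yv ^P suc c) ⊖ 1P) ⊛ (recipP (suc c) ⊛ multichoose (n ∸ suc c)))
      ≈⟨ ∑-cong-< n (rhsTerm-expand n) ⟩
    ∑[ c < n ] ∑[ k < n ] (V k ⊛ (natP (c C k) ⊛ multichoose (n ∸ suc c)))
      ≈⟨ ∑-comm n n _ ⟩
    ∑[ k < n ] ∑[ c < n ] (V k ⊛ (natP (c C k) ⊛ multichoose (n ∸ suc c)))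
      ≈⟨ ∑-cong n (λ k → *-distribˡ-∑ n (V k) _) ⟨
    ∑[ k < n ] (V k ⊛ ∑[ c < n ] (natP (c C k) ⊛ multichoose (n ∸ suc c)))
      ≈⟨ ∑-cong-< n (λ k k<n → ⊛-congˡ (V k) (R.trans (chu-vandermonde n k) (binomXCompl-≤ n (suc k) k<n))) ⟩
    ∑[ k < n ] (V k ⊛ binomX n (n ∸ suc k))
      ≈⟨ ∑-cong n (λ k → R.trans (R.*-assoc (recipP (suc k)) (Yv-1 ^P suc k) _)
                          (R.trans (⊛-congˡ (recipP (suc k)) (R.*-comm (Yv-1 ^P suc k) _))
                                   (R.sym (·-≐-cst-⊛ (recip (suc k)) _)))) ⟩
    ∑[ k < n ] (recip (suc k) · (binomX n (n ∸ suc k) ⊛ (Yv-1 ^P suc k)))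
      ≈⟨ rhsCoeff≐∑ n ⟨
    rhsCoeff n ∎
    where
    V : ℕ → Poly
    V k = recipP (suc k) ⊛ (Yv-1 ^P suc k)

open PolyRing
open PolyConstants
open RingSum commutativeRing
open PartitionLists
open MarkedPart
open FallingFactorials
open CycleIndex
open RightHandSide
open import Relation.Binary.Reasoning.Setoid R.setoid

mainTheorem1 : (n : ℕ) → n ≥ 1 → (L : List (List ℕ)) → Unique L
    → (∀ μ → μ ∈ L ⇔ IsPartition n μ)
    → lhsCoeff L ≐ rhsCoeff n
mainTheorem1 n _ L uniqueL L⇔ = begin
  lhsCoeff L
    ≈⟨ markedSum-decompose L⊢n yᵖ-1 ⟩
  ∑[ c < n ] (yᵖ-1 (suc c) ⊛ (recipP (suc c) ⊛ weightSum (withoutPart (suc c) L)))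
    ≈⟨ ∑-cong-< n (λ c c<n → ⊛-congˡ (yᵖ-1 (suc c)) (⊛-congˡ (recipP (suc c))
         (weightSum-multichoose (n ∸ suc c) (withoutPart-ListsPartitions (s≤s z≤n) c<n L⊢n)))) ⟩
  ∑[ c < n ] (yᵖ-1 (suc c) ⊛ (recipP (suc c) ⊛ multichoose (n ∸ suc c)))
    ≈⟨ multichooseSum≐rhsCoeff n ⟩
  rhsCoeff n ∎
  where
  L⊢n : ListsPartitions n L
  L⊢n = uniqueL , L⇔
  yᵖ-1 : ℕ → Poly
  yᵖ-1 p = (Yv ^P p) ⊖ 1P
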